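{- Let $q=2^m$ and let $a_1,a_3,a_4,a_5,b_1,\dots,b_5\in\mathbb{F}_q$. The polynomial system $(f_1,f_2)$ with $$f_1(x,y)=a_1x^2+a_3y^2+a_4x+a_5y,\qquad f_2(x,y)=b_1x^2+b_2xy+b_3y^2+b_4x+b_5y$$ is a permutation of $\mathbb{F}_q^2$ if and only if, possibly after interchanging the roles of the variables $x$ and $y$, one of the following holds: (i) $f_1=a_5y$ with $a_5\neq0$, and either $f_2=b_1x^2+b_3y^2+b_5y$ with $b_1\neq0$, or $f_2=b_3y^2+b_4x+b_5y$ with $b_4\neq0$; (ii) $f_1=a_4x+a_5y$ with $a_4\neq0$, $a_5\neq0$, and $f_2=b_1x^2+b_3y^2+b_4x+b_5y$ where exactly one of the equalities $a_4b_5+a_5b_4=0$ and $a_5^2b_1+a_4^2b_3=0$ holds; (iii) $f_1=a_3y^2$ with $a_3\neq0$, and either $f_2=b_1x^2+b_3y^2+b_5y$ with $b_1\neq0$, or $f_2=b_3y^2+b_4x+b_5y$ with $b_4\neq0$; (iv) $f_1=a_3y^2+a_4x+a_5y$ with $a_3\neq0$, $a_4\neq0$, and $f_2=b_1x^2+b_3y^2+b_4x+b_5y$ such that the polynomial $L_1(y)=A_1y^4+C_1y^2+D_1y$ has $0$ as its only root in $\mathbb{F}_{2^m}$, where $A_1=\frac{b_1a_3^2}{a_4^2}$, $C_1=b_3+\frac{b_1a_5^2}{a_4^2}+\frac{b_4a_3}{a_4}$, $D_1=\frac{b_4a_5}{a_4}+b_5$; (v) $f_1=a_1x^2+a_3y^2$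 with $a_1\neq0$, $a_3\neq0$, and $f_2=b_1x^2+b_3y^2+b_4x+b_5y$ where exactly one of the equalities $a_1b_3+a_3b_1=0$ and $a_1^{1/2}b_5+a_3^{1/2}b_4=0$ holds; (vi) $f_1=a_1x^2+a_3y^2+a_4x+a_5y$ with $a_1\neq0$, $a_3\neq0$ and $a_1^{1/2}a_5\neq a_3^{1/2}a_4$, and $f_2=b_1x^2+b_3y^2+b_4x+b_5y$ such that $L_2(Z)=d_1Z^4+d_2Z^2+d_3Z\in\mathbb{F}_{2^m}[Z]$ has $0$ as its only root in $\mathbb{F}_{2^m}$, where $d_1=\frac{a_1b_3+a_3b_1}{a_1a_3}$, $d_2=\frac{b_1a_5^2+b_3a_4^2}{a_1a_3}+\left(\frac{a_5}{a_3^{1/2}}+\frac{a_4}{a_1^{1/2}}\right)\left(\frac{b_4}{a_1^{1/2}}+\frac{b_5}{a_3^{1/2}}\right)$, $d_3=\left(\frac{a_4}{a_1^{1/2}}+\frac{a_5}{a_3^{1/2}}\right)\left(\frac{a_4b_5}{(a_1a_3)^{1/2}}+\frac{a_5b_4}{(a_1a_3)^{1/2}}\right)$.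
   Context: A system $(f_1,f_2)$ with $f_i\in\mathbb{F}_q[x,y]$ is a permutation of $\mathbb{F}_q^2$ if for every $(u,v)\in\mathbb{F}_q^2$ the system $f_1(x,y)=u$, $f_2(x,y)=v$ has exactly one solution $(x,y)\in\mathbb{F}_q^2$. In characteristic $2$, $c^{1/2}$ denotes the unique square root of $c\in\mathbb{F}_{2^m}$. -}

module Defs where

open import Level using (0ℓ)
open import Data.Nat using (ℕ; _^_)
open import Data.Product using (Σ; ∃; _×_; _,_)
open import Data.Sum using (_⊎_)
open import Data.List using (List; []; _∷_; length; filter)
open import Data.List.Membership.Propositional using (_∈_)
open import Data.List.Relation.Unary.Unique.Propositional using (Unique)
open import Relation.Nullary using (¬_)
open import Relation.Binary.Definitions using (DecidableEquality)
open import Relation.Binary.PropositionalEquality using (_≡_; _≢_)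
open import Algebra.Structures using (IsCommutativeRing)

-- A finite field of characteristic 2 with exactly 2^m elements (a model of F_{2^m};
-- all such fields are isomorphic).  Equality is propositional.
record F2Field (m : ℕ) : Set₁ where
  infixl 6 _+_
  infixl 7 _*_
  field
    Carrier : Set
    _+_ _*_ : Carrier → Carrier → Carrier
    -_ : Carrier → Carrier
    0# 1# : Carrier
    isCommutativeRing : IsCommutativeRing _≡_ _+_ _*_ -_ 0# 1#
    _≟_ : DecidableEquality Carrier
    0≢1 : 0# ≢ 1#
    inverse : ∀ x → x ≢ 0# → ∃ λ y → x * y ≡ 1#
    char2 : 1# + 1# ≡ 0#
    elements : List Carrier
    complete : ∀ x → x ∈ elements
    unique : Unique elements
    card : length elements ≡ 2 ^ m

record Coeffs (A : Set) : Set where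
  constructor coeffs
  field
    a1 a3 a4 a5 b1 b2 b3 b4 b5 : A

swapXY : ∀ {A} → Coeffs A → Coeffs A
swapXY (coeffs a1 a3 a4 a5 b1 b2 b3 b4 b5) = coeffs a3 a1 a5 a4 b3 b2 b1 b5 b4

ExactlyOne : Set → Set → Set
ExactlyOne P Q = (P × ¬ Q) ⊎ (¬ P × Q)

module _ {m : ℕ} (F : F2Field m) where
  open F2Field F

  firstOr : Carrier → List Carrier → Carrier
  firstOr d [] = d
  firstOr d (x ∷ _) = x

  -- c^{1/2}: the unique s with s * s = c (found by search over the field)
  sqrt : Carrier → Carrier
  sqrt c = firstOr 0# (filter (λ s → (s * s) ≟ c) elements)

  inv : Carrier → Carrier
  inv x = firstOr 0# (filter (λ y → (x * y) ≟ 1#) elements)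

  infixl 7 _/_
  _/_ : Carrier → Carrier → Carrier
  x / y = x * inv y

  sq : Carrier → Carrier
  sq x = x * x

  f1 : Coeffs Carrier → Carrier → Carrier → Carrier
  f1 c x y = a1 * sq x + a3 * sq y + a4 * x + a5 * y
    where open Coeffs c

  f2 : Coeffs Carrier → Carrier → Carrier → Carrier
  f2 c x y = b1 * sq x + b2 * (x * y) + b3 * sq y + b4 * x + b5 * y
    where open Coeffs c

  IsPermutation : Coeffs Carrier → Set
  IsPermutation c = ∀ u v → Σ (Carrier × Carrier) λ { (x , y) →
      (f1 c x y ≡ u × f2 c x y ≡ v) ×
      (∀ x' y' → f1 c x' y' ≡ u → f2 c x' y' ≡ v → (x' ≡ x × y' ≡ y)) }

  OnlyRootZero : Carrier → Carrier → Carrier → Set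
  OnlyRootZero d1 d2 d3 = ∀ z → d1 * sq (sq z) + d2 * sq z + d3 * z ≡ 0# → z ≡ 0#

  F2Alt : Coeffs Carrier → Set
  F2Alt c = (b2 ≡ 0# × b4 ≡ 0# × b1 ≢ 0#) ⊎ (b1 ≡ 0# × b2 ≡ 0# × b4 ≢ 0#)
    where open Coeffs c

  Case1 Case2 Case3 Case4 Case5 Case6 : Coeffs Carrier → Set
  Case1 c = a1 ≡ 0# × a3 ≡ 0# × a4 ≡ 0# × a5 ≢ 0# × F2Alt c
    where open Coeffs c
  Case2 c = a1 ≡ 0# × a3 ≡ 0# × a4 ≢ 0# × a5 ≢ 0# × b2 ≡ 0# ×
            ExactlyOne (a4 * b5 + a5 * b4 ≡ 0#) (sq a5 * b1 + sq a4 * b3 ≡ 0#)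
    where open Coeffs c
  Case3 c = a1 ≡ 0# × a4 ≡ 0# × a5 ≡ 0# × a3 ≢ 0# × F2Alt c
    where open Coeffs c
  Case4 c = a1 ≡ 0# × a3 ≢ 0# × a4 ≢ 0# × b2 ≡ 0# × OnlyRootZero A₁ C₁ D₁
    where
      open Coeffs c
      A₁ = (b1 * sq a3) / sq a4
      C₁ = b3 + (b1 * sq a5) / sq a4 + (b4 * a3) / a4
      D₁ = (b4 * a5) / a4 + b5
  Case5 c = a4 ≡ 0# × a5 ≡ 0# × a1 ≢ 0# × a3 ≢ 0# × b2 ≡ 0# ×
            ExactlyOne (a1 * b3 + a3 * b1 ≡ 0#) (sqrt a1 * b5 + sqrt a3 * b4 ≡ 0#)
    where open Coeffs c
  Case6 c = a1 ≢ 0# × a3 ≢ 0# × sqrt a1 * a5 ≢ sqrt a3 * a4 × b2 ≡ 0# ×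
            OnlyRootZero d1 d2 d3
    where
      open Coeffs c
      d1 = (a1 * b3 + a3 * b1) / (a1 * a3)
      d2 = (b1 * sq a5 + b3 * sq a4) / (a1 * a3)
           + (a5 / sqrt a3 + a4 / sqrt a1) * (b4 / sqrt a1 + b5 / sqrt a3)
      d3 = (a4 / sqrt a1 + a5 / sqrt a3)
           * ((a4 * b5) / sqrt (a1 * a3) + (a5 * b4) / sqrt (a1 * a3))

  OneOfCases : Coeffs Carrier → Set
  OneOfCases c = Case1 c ⊎ Case2 c ⊎ Case3 c ⊎ Case4 c ⊎ Case5 c ⊎ Case6 c

{-# OPTIONS --safe #-}

-- In characteristic 2 squaring is additive, so when b2 = 0 both f1 and f2 are additive and (f1, f2)
-- is an endomorphism of the finite group F_q²: it is a permutation iff its kernel {f1 = 0 = f2} is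
-- trivial. When b2 ≠ 0, shifting a point by a nonzero root (h, k) of f1 changes f2 by
-- f2(h, k) + b2 (x k + h y), which vanishes for suitable (x, y), so there is a collision.
-- The kernel is decided by parametrising the zero set of f1 by one variable v (a line, a graph
-- x = g(y), or the parabola (√a1 x + √a3 y)² = a4 x + a5 y); the kernel is trivial iff f2 restricted
-- to it has only the root v = 0. On a line this restriction is P v² + Q v, whose only root is 0 iff
-- exactly one of P, Q vanishes; on the graph it is L₁, on the parabola L₂ up to rescaling v. In the
-- remaining configurations f1 vanishes on two parallel lines, which always carry a nonzero kernel point.

module Submission where

open import Defs
open import Level using (0ℓ)
open import Data.Nat using (ℕ; zero; suc)
import Data.Nat as ℕ
open import Data.Nat.Properties using (n<1+n)
open import Data.Bool using (Bool; true; false; _xor_; _∧_)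
open import Data.Maybe using (Maybe; just; nothing)
open import Data.Fin using (Fin; zero; suc; punchOut)
open import Data.Fin.Properties using (punchOut-injective; pigeonhole; <⇒≢; any?; *↔×)
import Data.Fin.Properties as Fin
open import Data.List using (List; _∷_; length; lookup; filter)
open import Data.List.Membership.Propositional using (_∈_)
import Data.List.Relation.Unary.All as All
open import Data.List.Membership.Propositional.Properties using (∈-lookup)
open import Data.List.Relation.Unary.AllPairs using (_∷_)
open import Data.List.Relation.Unary.Any using (here; there; index)
open import Data.List.Relation.Unary.Any.Properties using (lookup-index)
open import Data.List.Relation.Unary.Unique.Propositional using (Unique)
open import Data.Product using (∃; ∃₂; _×_; _,_; proj₁; proj₂; swap)
open import Data.Product.Function.NonDependent.Propositional using (_×-↔_)
open import Data.Sum using (_⊎_; inj₁; inj₂; [_,_]′)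
import Data.Sum as Sum
open import Data.Empty using (⊥-elim)
open import Function using (id; _∘_; _↔_; _⇔_; mk↔ₛ′; mk⇔; Inverse; Injection; Equivalence)
open import Function.Definitions using (Injective; StrictlySurjective)
open import Function.Properties.Inverse using (↔-sym; ↔-trans; ↔⇒↣)
open import Function.Properties.Equivalence using () renaming (trans to ⇔-trans)
open import Algebra.Bundles using (CommutativeRing; RawRing)
open import Algebra.Solver.Ring.AlmostCommutativeRing
  using (fromCommutativeRing; _-Raw-AlmostCommutative⟶_)
open import Relation.Nullary using (¬_; yes; no; contradiction)
open import Relation.Unary using (Decidable)
open import Relation.Binary.PropositionalEquality

Fin-injective⇒surjective : ∀ {n} (f : Fin n → Fin n) → Injective _≡_ _≡_ f → StrictlySurjective _≡_ f
Fin-injective⇒surjective {zero} f inj ()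
Fin-injective⇒surjective {suc n} f inj k with any? (λ i → f i Fin.≟ k)
... | yes hit = hit
... | no miss =
  let i , j , i<j , eq = pigeonhole (n<1+n n) (λ i → punchOut (f≢k i))
  in contradiction (inj (punchOut-injective (f≢k i) (f≢k j) eq)) (<⇒≢ i<j)
  where
    f≢k : ∀ i → k ≢ f i
    f≢k i k≡fi = miss (i , sym k≡fi)

injective⇒surjective : ∀ {A : Set} {n} → A ↔ Fin n →
  (h : A → A) → Injective _≡_ _≡_ h → StrictlySurjective _≡_ h
injective⇒surjective A↔Fin h inj y =
  let i , e = Fin-injective⇒surjective (to ∘ h ∘ from) inj′ (to y) in
  from i , (begin
    h (from i)             ≡⟨ strictlyInverseʳ _ ⟨
    from (to (h (from i))) ≡⟨ cong from e ⟩
    from (to y)            ≡⟨ strictlyInverseʳ y ⟩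
    y                      ∎)
  where
    open Inverse A↔Fin
    open ≡-Reasoning
    inj′ : Injective _≡_ _≡_ (to ∘ h ∘ from)
    inj′ = Injection.injective (↔⇒↣ (↔-sym A↔Fin)) ∘ inj ∘ Injection.injective (↔⇒↣ A↔Fin)

lookup-injective : ∀ {A : Set} {xs : List A} → Unique xs → Injective _≡_ _≡_ (lookup xs)
lookup-injective {xs = _ ∷ _} (_ ∷ _)   {zero}  {zero}  _ = refl
lookup-injective {xs = _ ∷ _} (x∉ ∷ _)  {zero}  {suc j} e = contradiction e (All.lookup x∉ (∈-lookup j))
lookup-injective {xs = _ ∷ _} (x∉ ∷ _)  {suc i} {zero}  e = contradiction (sym e) (All.lookup x∉ (∈-lookup i))
lookup-injective {xs = _ ∷ _} (_ ∷ xs!) {suc i} {suc j} e = cong suc (lookup-injective xs! e)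

enumeration⇒↔Fin : ∀ {A : Set} (xs : List A) → (∀ x → x ∈ xs) → Unique xs → A ↔ Fin (length xs)
enumeration⇒↔Fin xs complete unique = mk↔ₛ′ (index ∘ complete) (lookup xs)
  (λ i → lookup-injective unique (sym (lookup-index (complete (lookup xs i)))))
  (λ x → sym (lookup-index (complete x)))

exactlyOne-swap : ∀ {A B : Set} → ExactlyOne A B → ExactlyOne B A
exactlyOne-swap (inj₁ (a , ¬b)) = inj₂ (¬b , a)
exactlyOne-swap (inj₂ (¬a , b)) = inj₁ (b , ¬a)

GF2 : RawRing 0ℓ 0ℓ
GF2 = record
  { Carrier = Bool ; _≈_ = _≡_ ; _+_ = _xor_ ; _*_ = _∧_ ; -_ = λ b → b ; 0# = false ; 1# = true }

module _ {m : ℕ} (F : F2Field m) where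
  open F2Field F

  private
    ring : CommutativeRing 0ℓ 0ℓ
    ring = record { isCommutativeRing = isCommutativeRing }

  open CommutativeRing ring using
    ( +-comm; +-assoc; +-identityˡ; +-identityʳ; -‿inverseʳ
    ; *-comm; *-assoc; *-identityˡ; *-identityʳ; distribˡ; distribʳ; zeroˡ; zeroʳ )
  open ≡-Reasoning

  x+x≡0 : ∀ x → x + x ≡ 0#
  x+x≡0 x = begin
    x + x               ≡⟨ cong₂ _+_ (*-identityˡ x) (*-identityˡ x) ⟨
    1# * x + 1# * x     ≡⟨ distribʳ x 1# 1# ⟨
    (1# + 1#) * x       ≡⟨ cong (_* x) char2 ⟩
    0# * x              ≡⟨ zeroˡ x ⟩
    0#                  ∎

  x+y≡0⇒x≡y : ∀ {x y} → x + y ≡ 0# → x ≡ y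
  x+y≡0⇒x≡y {x} {y} e = begin
    x             ≡⟨ +-identityʳ x ⟨
    x + 0#        ≡⟨ cong (x +_) (x+x≡0 y) ⟨
    x + (y + y)   ≡⟨ +-assoc x y y ⟨
    (x + y) + y   ≡⟨ cong (_+ y) e ⟩
    0# + y        ≡⟨ +-identityˡ y ⟩
    y             ∎

  x≡y⇒x+y≡0 : ∀ {x y} → x ≡ y → x + y ≡ 0#
  x≡y⇒x+y≡0 {x} refl = x+x≡0 x

  x+h≡x⇒h≡0 : ∀ {x h} → x + h ≡ x → h ≡ 0#
  x+h≡x⇒h≡0 {x} {h} x+h≡x = begin
    h              ≡⟨ +-identityˡ h ⟨
    0# + h         ≡⟨ cong (_+ h) (x+x≡0 x) ⟨
    (x + x) + h    ≡⟨ +-assoc x x h ⟩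
    x + (x + h)    ≡⟨ cong (x +_) x+h≡x ⟩
    x + x          ≡⟨ x+x≡0 x ⟩
    0#             ∎

  -x≡x : ∀ x → - x ≡ x
  -x≡x x = x+y≡0⇒x≡y (trans (+-comm (- x) x) (-‿inverseʳ x))

  -- Identities are normalised with coefficients in GF(2), so the solver knows 1 + 1 = 0.
  private
    ⟦_⟧₂ : Bool → Carrier
    ⟦ true ⟧₂ = 1#
    ⟦ false ⟧₂ = 0#

    GF2⟶F : GF2 -Raw-AlmostCommutative⟶ fromCommutativeRing ring
    GF2⟶F = record
      { ⟦_⟧ = ⟦_⟧₂
      ; +-homo = +-homo
      ; *-homo = *-homo
      ; -‿homo = λ b → sym (-x≡x ⟦ b ⟧₂)
      ; 0-homo = refl
      ; 1-homo = refl }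
      where
        +-homo : ∀ a b → ⟦ a xor b ⟧₂ ≡ ⟦ a ⟧₂ + ⟦ b ⟧₂
        +-homo true true = sym char2
        +-homo true false = sym (+-identityʳ 1#)
        +-homo false b = sym (+-identityˡ _)
        *-homo : ∀ a b → ⟦ a ∧ b ⟧₂ ≡ ⟦ a ⟧₂ * ⟦ b ⟧₂
        *-homo true b = sym (*-identityˡ _)
        *-homo false b = sym (zeroˡ _)

    ⟦⟧₂-≟ : ∀ a b → Maybe (⟦ a ⟧₂ ≡ ⟦ b ⟧₂)
    ⟦⟧₂-≟ true true = just refl
    ⟦⟧₂-≟ false false = just refl
    ⟦⟧₂-≟ _ _ = nothing

  open import Algebra.Solver.Ring GF2 (fromCommutativeRing ring) GF2⟶F ⟦⟧₂-≟
    using (Polynomial; solve; _:=_; _:+_; _:*_; con)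

  private
    :0 :1 : ∀ {n} → Polynomial n
    :0 = con false
    :1 = con true

  infix 9 _⁻¹
  _⁻¹ : Carrier → Carrier
  x ⁻¹ = inv F x

  infix 8 √_
  √_ : Carrier → Carrier
  √ x = sqrt F x

  firstOr-filter : ∀ {P : Carrier → Set} (P? : Decidable P) d {w} xs →
    w ∈ xs → P w → P (firstOr F d (filter P? xs))
  firstOr-filter P? d (x ∷ xs) w∈ Pw with P? x | w∈
  ... | yes Px | _ = Px
  ... | no ¬Px | here refl = contradiction Pw ¬Px
  ... | no ¬Px | there w∈xs = firstOr-filter P? d xs w∈xs Pw

  1≢0 : 1# ≢ 0#
  1≢0 1≡0 = 0≢1 (sym 1≡0)

  x*x⁻¹≡1 : ∀ {x} → x ≢ 0# → x * x ⁻¹ ≡ 1#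
  x*x⁻¹≡1 {x} x≢0 = let y , xy≡1 = inverse x x≢0 in
    firstOr-filter (λ y → (x * y) ≟ 1#) 0# elements (complete y) xy≡1

  x*y≡1⇒y≢0 : ∀ {x y} → x * y ≡ 1# → y ≢ 0#
  x*y≡1⇒y≢0 {x} xy≡1 y≡0 = 0≢1 (trans (sym (zeroʳ x)) (trans (cong (x *_) (sym y≡0)) xy≡1))

  ⁻¹-unique : ∀ {x y} → x * y ≡ 1# → x ⁻¹ ≡ y
  ⁻¹-unique {x} {y} xy≡1 = begin
    x ⁻¹               ≡⟨ *-identityʳ _ ⟨
    x ⁻¹ * 1#          ≡⟨ cong (x ⁻¹ *_) xy≡1 ⟨
    x ⁻¹ * (x * y)     ≡⟨ *-assoc _ _ _ ⟨
    (x ⁻¹ * x) * y     ≡⟨ cong (_* y) (trans (*-comm _ _) (x*x⁻¹≡1 x≢0)) ⟩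
    1# * y             ≡⟨ *-identityˡ y ⟩
    y                  ∎
    where
      x≢0 : x ≢ 0#
      x≢0 = x*y≡1⇒y≢0 (trans (*-comm y x) xy≡1)

  x*y≡0⇒x≡0∨y≡0 : ∀ {x y} → x * y ≡ 0# → x ≡ 0# ⊎ y ≡ 0#
  x*y≡0⇒x≡0∨y≡0 {x} {y} xy≡0 with x ≟ 0#
  ... | yes x≡0 = inj₁ x≡0
  ... | no x≢0 = inj₂ (begin
    y                 ≡⟨ *-identityˡ y ⟨
    1# * y            ≡⟨ cong (_* y) (trans (*-comm _ _) (x*x⁻¹≡1 x≢0)) ⟨
    (x ⁻¹ * x) * y    ≡⟨ *-assoc _ _ _ ⟩
    x ⁻¹ * (x * y)    ≡⟨ cong (x ⁻¹ *_) xy≡0 ⟩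
    x ⁻¹ * 0#         ≡⟨ zeroʳ _ ⟩
    0#                ∎)

  *-cancelˡ-≡0 : ∀ {x y} → x ≢ 0# → x * y ≡ 0# → y ≡ 0#
  *-cancelˡ-≡0 x≢0 xy≡0 with x*y≡0⇒x≡0∨y≡0 xy≡0
  ... | inj₁ x≡0 = contradiction x≡0 x≢0
  ... | inj₂ y≡0 = y≡0

  inverse-unique : ∀ {x y z} → x * y ≡ 1# → x * z ≡ 1# → y ≡ z
  inverse-unique xy≡1 xz≡1 = trans (sym (⁻¹-unique xy≡1)) (⁻¹-unique xz≡1)

  *-cancelˡ-≡ : ∀ {d x y} → d ≢ 0# → d * x ≡ d * y → x ≡ y
  *-cancelˡ-≡ {d} {x} {y} d≢0 dx≡dy =
    x+y≡0⇒x≡y (*-cancelˡ-≡0 d≢0 (trans (distribˡ d x y) (x≡y⇒x+y≡0 dx≡dy)))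

  x*y≢0 : ∀ {x y} → x ≢ 0# → y ≢ 0# → x * y ≢ 0#
  x*y≢0 x≢0 y≢0 xy≡0 = y≢0 (*-cancelˡ-≡0 x≢0 xy≡0)

  x⁻¹≢0 : ∀ {x} → x ≢ 0# → x ⁻¹ ≢ 0#
  x⁻¹≢0 x≢0 = x*y≡1⇒y≢0 (x*x⁻¹≡1 x≢0)

  x*x≡0⇒x≡0 : ∀ {x} → x * x ≡ 0# → x ≡ 0#
  x*x≡0⇒x≡0 xx≡0 = [ id , id ]′ (x*y≡0⇒x≡0∨y≡0 xx≡0)

  sq-+ : ∀ x y → (x + y) * (x + y) ≡ x * x + y * y
  sq-+ = solve 2 (λ x y → (x :+ y) :* (x :+ y) := x :* x :+ y :* y) refl

  sq-injective : Injective _≡_ _≡_ (λ x → x * x)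
  sq-injective {x} {y} x²≡y² = x+y≡0⇒x≡y (x*x≡0⇒x≡0 (trans (sq-+ x y) (x≡y⇒x+y≡0 x²≡y²)))

  x*x⁻¹*y≡y : ∀ {x} → x ≢ 0# → ∀ y → x * x ⁻¹ * y ≡ y
  x*x⁻¹*y≡y x≢0 y = trans (cong (_* y) (x*x⁻¹≡1 x≢0)) (*-identityˡ y)

  x*[y*x⁻¹]≡y : ∀ {x} → x ≢ 0# → ∀ y → x * (y * x ⁻¹) ≡ y
  x*[y*x⁻¹]≡y {x} x≢0 y =
    trans (solve 3 (λ x y x⁻¹ → x :* (y :* x⁻¹) := x :* x⁻¹ :* y) refl x y (x ⁻¹)) (x*x⁻¹*y≡y x≢0 y)

  Carrier↔Fin : Carrier ↔ Fin (length elements)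
  Carrier↔Fin = enumeration⇒↔Fin elements complete unique

  sq-surjective : StrictlySurjective _≡_ (λ x → x * x)
  sq-surjective = injective⇒surjective Carrier↔Fin _ sq-injective

  √c*√c≡c : ∀ c → √ c * √ c ≡ c
  √c*√c≡c c = let s , s²≡c = sq-surjective c in
    firstOr-filter (λ s → (s * s) ≟ c) 0# elements (complete s) s²≡c

  √-unique : ∀ {s c} → s * s ≡ c → √ c ≡ s
  √-unique {s} {c} s²≡c = sq-injective (trans (√c*√c≡c c) (sym s²≡c))

  √≢0 : ∀ {c} → c ≢ 0# → √ c ≢ 0#
  √≢0 {c} c≢0 √c≡0 = c≢0 (begin
    c             ≡⟨ √c*√c≡c c ⟨
    √ c * √ c     ≡⟨ cong₂ _*_ √c≡0 √c≡0 ⟩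
    0# * 0#       ≡⟨ zeroˡ 0# ⟩
    0#            ∎)

  TrivialRoots : (Carrier → Carrier) → Set
  TrivialRoots g = ∀ v → g v ≡ 0# → v ≡ 0#

  trivialRoots-cong : ∀ {g h} → (∀ v → g v ≡ h v) → TrivialRoots g ⇔ TrivialRoots h
  trivialRoots-cong g≗h = mk⇔ (λ g! v hv≡0 → g! v (trans (g≗h v) hv≡0))
                             (λ h! v gv≡0 → h! v (trans (sym (g≗h v)) gv≡0))

  trivialRoots-rescale : ∀ {g h D μ} → D ≢ 0# → μ ≢ 0# → (∀ v → h (D * v) ≡ μ * g v) →
    TrivialRoots g ⇔ TrivialRoots h
  trivialRoots-rescale {g} {h} {D} {μ} D≢0 μ≢0 h∘D≡μg = mk⇔ to from
    where
      to : TrivialRoots g → TrivialRoots h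
      to g! z hz≡0 = begin
        z                 ≡⟨ x*x⁻¹*y≡y D≢0 z ⟨
        D * D ⁻¹ * z      ≡⟨ *-assoc D _ z ⟩
        D * (D ⁻¹ * z)    ≡⟨ cong (D *_) (g! (D ⁻¹ * z) (*-cancelˡ-≡0 μ≢0 (begin
          μ * g (D ⁻¹ * z)     ≡⟨ h∘D≡μg (D ⁻¹ * z) ⟨
          h (D * (D ⁻¹ * z))   ≡⟨ cong h (trans (sym (*-assoc D _ z)) (x*x⁻¹*y≡y D≢0 z)) ⟩
          h z                  ≡⟨ hz≡0 ⟩
          0#                   ∎))) ⟩
        D * 0#            ≡⟨ zeroʳ D ⟩
        0#                ∎
      from : TrivialRoots h → TrivialRoots g
      from h! v gv≡0 = *-cancelˡ-≡0 D≢0 (h! (D * v) (begin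
        h (D * v)    ≡⟨ h∘D≡μg v ⟩
        μ * g v      ≡⟨ cong (μ *_) gv≡0 ⟩
        μ * 0#       ≡⟨ zeroʳ μ ⟩
        0#           ∎))

  linearised : Carrier → Carrier → Carrier → Carrier
  linearised P Q t = P * (t * t) + Q * t

  linearised-root : ∀ {P} Q → P ≢ 0# → linearised P Q (Q * P ⁻¹) ≡ 0#
  linearised-root {P} Q P≢0 = begin
    P * ((Q * P ⁻¹) * (Q * P ⁻¹)) + Q * (Q * P ⁻¹)
      ≡⟨ solve 3 (λ P Q P⁻¹ → P :* ((Q :* P⁻¹) :* (Q :* P⁻¹)) :+ Q :* (Q :* P⁻¹)
                            := P :* P⁻¹ :* (Q :* Q :* P⁻¹) :+ Q :* Q :* P⁻¹) refl P Q (P ⁻¹) ⟩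
    P * P ⁻¹ * (Q * Q * P ⁻¹) + Q * Q * P ⁻¹
      ≡⟨ cong (_+ Q * Q * P ⁻¹) (x*x⁻¹*y≡y P≢0 _) ⟩
    Q * Q * P ⁻¹ + Q * Q * P ⁻¹
      ≡⟨ x+x≡0 _ ⟩
    0# ∎

  linearised-0-0 : ∀ t → linearised 0# 0# t ≡ 0#
  linearised-0-0 = solve 1 (λ t → :0 :* (t :* t) :+ :0 :* t := :0) refl

  linearised-factor : ∀ P Q t → t * (P * t + Q) ≡ linearised P Q t
  linearised-factor = solve 3 (λ P Q t → t :* (P :* t :+ Q) := P :* (t :* t) :+ Q :* t) refl

  trivialRoots⇒exactlyOne : ∀ P Q → TrivialRoots (linearised P Q) → ExactlyOne (P ≡ 0#) (Q ≡ 0#)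
  trivialRoots⇒exactlyOne P Q triv with P ≟ 0# | Q ≟ 0#
  ... | yes P≡0 | no Q≢0 = inj₁ (P≡0 , Q≢0)
  ... | no P≢0 | yes Q≡0 = inj₂ (P≢0 , Q≡0)
  ... | yes refl | yes refl = contradiction (sym (triv 1# (linearised-0-0 1#))) 0≢1
  ... | no P≢0 | no Q≢0 =
    contradiction (triv (Q * P ⁻¹) (linearised-root Q P≢0)) (x*y≢0 Q≢0 (x⁻¹≢0 P≢0))

  exactlyOne⇒trivialRoots : ∀ P Q → ExactlyOne (P ≡ 0#) (Q ≡ 0#) → TrivialRoots (linearised P Q)
  exactlyOne⇒trivialRoots P Q one t root with x*y≡0⇒x≡0∨y≡0 (trans (linearised-factor P Q t) root)
  ... | inj₁ t≡0 = t≡0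
  ... | inj₂ Pt+Q≡0 with one
  ...   | inj₁ (refl , Q≢0) =
          contradiction (trans (solve 2 (λ t Q → Q := :0 :* t :+ Q) refl t Q) Pt+Q≡0) Q≢0
  ...   | inj₂ (P≢0 , refl) = *-cancelˡ-≡0 P≢0 (trans (sym (+-identityʳ _)) Pt+Q≡0)

  trivialRoots-linearised : ∀ P Q → TrivialRoots (linearised P Q) ⇔ ExactlyOne (P ≡ 0#) (Q ≡ 0#)
  trivialRoots-linearised P Q = mk⇔ (trivialRoots⇒exactlyOne P Q) (exactlyOne⇒trivialRoots P Q)

  linearised-nonzeroRoot⊎hits : ∀ P Q c → (∃ λ t → t ≢ 0# × linearised P Q t ≡ 0#) ⊎ (∃ λ t → linearised P Q t ≡ c)
  linearised-nonzeroRoot⊎hits P Q c with P ≟ 0# | Q ≟ 0#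
  ... | yes refl | yes refl = inj₁ (1# , 1≢0 , linearised-0-0 1#)
  ... | no P≢0 | no Q≢0 = inj₁ (Q * P ⁻¹ , x*y≢0 Q≢0 (x⁻¹≢0 P≢0) , linearised-root Q P≢0)
  ... | yes refl | no Q≢0 = inj₂ (c * Q ⁻¹ , (begin
    0# * ((c * Q ⁻¹) * (c * Q ⁻¹)) + Q * (c * Q ⁻¹)  ≡⟨ cong (_+ Q * (c * Q ⁻¹)) (zeroˡ _) ⟩
    0# + Q * (c * Q ⁻¹)                               ≡⟨ +-identityˡ _ ⟩
    Q * (c * Q ⁻¹)                                    ≡⟨ x*[y*x⁻¹]≡y Q≢0 c ⟩
    c                                                 ∎))
  ... | no P≢0 | yes refl = inj₂ (s , (begin
    P * (s * s) + 0# * s    ≡⟨ cong (λ s² → P * s² + 0# * s) (√c*√c≡c _) ⟩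
    P * (c * P ⁻¹) + 0# * s ≡⟨ solve 4 (λ P c P⁻¹ s → P :* (c :* P⁻¹) :+ :0 :* s := P :* P⁻¹ :* c)
                                      refl P c (P ⁻¹) s ⟩
    P * P ⁻¹ * c            ≡⟨ x*x⁻¹*y≡y P≢0 c ⟩
    c                       ∎))
    where s = √ (c * P ⁻¹)

  f1-+ : ∀ c x y h k → f1 F c (x + h) (y + k) ≡ f1 F c x y + f1 F c h k
  f1-+ (coeffs a1 a3 a4 a5 _ _ _ _ _) = solve 8 (λ a1 a3 a4 a5 x y h k →
    a1 :* ((x :+ h) :* (x :+ h)) :+ a3 :* ((y :+ k) :* (y :+ k)) :+ a4 :* (x :+ h) :+ a5 :* (y :+ k)
    := (a1 :* (x :* x) :+ a3 :* (y :* y) :+ a4 :* x :+ a5 :* y)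
       :+ (a1 :* (h :* h) :+ a3 :* (k :* k) :+ a4 :* h :+ a5 :* k)) refl a1 a3 a4 a5

  f2-+ : ∀ c x y h k → f2 F c (x + h) (y + k) ≡ f2 F c x y + f2 F c h k + Coeffs.b2 c * (x * k + h * y)
  f2-+ (coeffs _ _ _ _ b1 b2 b3 b4 b5) = solve 9 (λ b1 b2 b3 b4 b5 x y h k →
    b1 :* ((x :+ h) :* (x :+ h)) :+ b2 :* ((x :+ h) :* (y :+ k)) :+ b3 :* ((y :+ k) :* (y :+ k))
      :+ b4 :* (x :+ h) :+ b5 :* (y :+ k)
    := (b1 :* (x :* x) :+ b2 :* (x :* y) :+ b3 :* (y :* y) :+ b4 :* x :+ b5 :* y)
       :+ (b1 :* (h :* h) :+ b2 :* (h :* k) :+ b3 :* (k :* k) :+ b4 :* h :+ b5 :* k)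
       :+ b2 :* (x :* k :+ h :* y)) refl b1 b2 b3 b4 b5

  f2-+-b2≡0 : ∀ c → Coeffs.b2 c ≡ 0# → ∀ x y h k → f2 F c (x + h) (y + k) ≡ f2 F c x y + f2 F c h k
  f2-+-b2≡0 c b2≡0 x y h k = begin
    f2 F c (x + h) (y + k)          ≡⟨ f2-+ c x y h k ⟩
    s + Coeffs.b2 c * w             ≡⟨ cong (λ b → s + b * w) b2≡0 ⟩
    s + 0# * w                      ≡⟨ cong (s +_) (zeroˡ w) ⟩
    s + 0#                          ≡⟨ +-identityʳ s ⟩
    s                               ∎
    where
      s = f2 F c x y + f2 F c h k
      w = x * k + h * y

  f2-on-line : ∀ c → Coeffs.b2 c ≡ 0# → ∀ p q v →
    f2 F c (p * v) (q * v) ≡ linearised (Coeffs.b1 c * (p * p) + Coeffs.b3 c * (q * q)) (Coeffs.b4 c * p + Coeffs.b5 c * q) v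
  f2-on-line (coeffs _ _ _ _ b1 _ b3 b4 b5) refl = solve 7 (λ b1 b3 b4 b5 p q v →
    b1 :* ((p :* v) :* (p :* v)) :+ :0 :* ((p :* v) :* (q :* v)) :+ b3 :* ((q :* v) :* (q :* v))
      :+ b4 :* (p :* v) :+ b5 :* (q :* v)
    := (b1 :* (p :* p) :+ b3 :* (q :* q)) :* (v :* v) :+ (b4 :* p :+ b5 :* q) :* v) refl b1 b3 b4 b5

  TrivialKernel : Coeffs Carrier → Set
  TrivialKernel c = ∀ x y → f1 F c x y ≡ 0# → f2 F c x y ≡ 0# → x ≡ 0# × y ≡ 0#

  record ZeroSetParametrisation (c : Coeffs Carrier) : Set where
    field
      φx φy        : Carrier → Carrier
      on-zero-set  : ∀ v → f1 F c (φx v) (φy v) ≡ 0#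
      covers       : ∀ x y → f1 F c x y ≡ 0# → ∃ λ v → φx v ≡ x × φy v ≡ y
      origin-fibre : ∀ v → φx v ≡ 0# → φy v ≡ 0# → v ≡ 0#
      φx-0         : φx 0# ≡ 0#
      φy-0         : φy 0# ≡ 0#

  trivialKernel⇔trivialRoots : ∀ {c} (φ : ZeroSetParametrisation c) → let open ZeroSetParametrisation φ in
    TrivialKernel c ⇔ TrivialRoots (λ v → f2 F c (φx v) (φy v))
  trivialKernel⇔trivialRoots {c} φ = mk⇔ to from
    where
      open ZeroSetParametrisation φ
      to : TrivialKernel c → TrivialRoots (λ v → f2 F c (φx v) (φy v))
      to triv v f2φv≡0 = let φxv≡0 , φyv≡0 = triv (φx v) (φy v) (on-zero-set v) f2φv≡0 in
        origin-fibre v φxv≡0 φyv≡0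
      from : TrivialRoots (λ v → f2 F c (φx v) (φy v)) → TrivialKernel c
      from triv x y f1≡0 f2≡0 with covers x y f1≡0
      ... | v , refl , refl with triv v f2≡0
      ...   | refl = φx-0 , φy-0

  lineParametrisation : ∀ {c} p q → p ≢ 0# →
    (∀ v → f1 F c (p * v) (q * v) ≡ 0#) →
    (∀ x y → f1 F c x y ≡ 0# → q * x ≡ p * y) →
    ZeroSetParametrisation c
  lineParametrisation p q p≢0 on-line on-line⁻¹ = record
    { φx = p *_
    ; φy = q *_
    ; on-zero-set = on-line
    ; covers = λ x y f1≡0 → x * p ⁻¹ , x*[y*x⁻¹]≡y p≢0 x , q[x/p]≡y x y (on-line⁻¹ x y f1≡0)
    ; origin-fibre = λ v pv≡0 _ → *-cancelˡ-≡0 p≢0 pv≡0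
    ; φx-0 = zeroʳ p
    ; φy-0 = zeroʳ q
    }
    where
      q[x/p]≡y : ∀ x y → q * x ≡ p * y → q * (x * p ⁻¹) ≡ y
      q[x/p]≡y x y qx≡py = begin
        q * (x * p ⁻¹)   ≡⟨ *-assoc q x _ ⟨
        q * x * p ⁻¹     ≡⟨ cong (_* p ⁻¹) qx≡py ⟩
        p * y * p ⁻¹     ≡⟨ solve 3 (λ p y p⁻¹ → p :* y :* p⁻¹ := p :* p⁻¹ :* y) refl p y (p ⁻¹) ⟩
        p * p ⁻¹ * y     ≡⟨ x*x⁻¹*y≡y p≢0 y ⟩
        y                ∎

  trivialKernel-line : ∀ c → Coeffs.b2 c ≡ 0# → ∀ p q {P Q} → p ≢ 0# →
    (∀ v → f1 F c (p * v) (q * v) ≡ 0#) →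
    (∀ x y → f1 F c x y ≡ 0# → q * x ≡ p * y) →
    Coeffs.b1 c * (p * p) + Coeffs.b3 c * (q * q) ≡ P → Coeffs.b4 c * p + Coeffs.b5 c * q ≡ Q →
    TrivialKernel c ⇔ ExactlyOne (P ≡ 0#) (Q ≡ 0#)
  trivialKernel-line c b2≡0 p q p≢0 on-line on-line⁻¹ refl refl =
    ⇔-trans (trivialKernel⇔trivialRoots (lineParametrisation p q p≢0 on-line on-line⁻¹))
    (⇔-trans (trivialRoots-cong (f2-on-line c b2≡0 p q)) (trivialRoots-linearised _ _))

  -- By additivity f1 also vanishes on the line through w parallel to (p, q); on the first line
  -- f2 is a linearised polynomial, which either has a nonzero root or takes the value f2(w).
  ¬trivialKernel-parallelZeroLines : ∀ c → Coeffs.b2 c ≡ 0# → ∀ p q wx wy →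
    (∀ u → f1 F c (p * u) (q * u) ≡ 0#) → f1 F c wx wy ≡ 0# → p * wy + q * wx ≢ 0# →
    ¬ TrivialKernel c
  ¬trivialKernel-parallelZeroLines c b2≡0 p q wx wy on-line f1w≡0 det≢0 triv
    with linearised-nonzeroRoot⊎hits _ _ (f2 F c wx wy)
  ... | inj₁ (u , u≢0 , root) =
    let pu≡0 , qu≡0 = triv (p * u) (q * u) (on-line u) (trans (f2-on-line c b2≡0 p q u) root) in
    det≢0 (begin
      p * wy + q * wx     ≡⟨ cong₂ (λ p q → p * wy + q * wx) (*-cancelˡ-≡0 u≢0 (trans (*-comm u p) pu≡0))
                                                             (*-cancelˡ-≡0 u≢0 (trans (*-comm u q) qu≡0)) ⟩
      0# * wy + 0# * wx   ≡⟨ solve 2 (λ wx wy → :0 :* wy :+ :0 :* wx := :0) refl wx wy ⟩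
      0#                  ∎)
  ... | inj₂ (u , hits) =
    let wx+pu≡0 , wy+qu≡0 = triv (wx + p * u) (wy + q * u) f1≡0 f2≡0 in
    det≢0 (begin
      p * wy + q * wx             ≡⟨ cong₂ (λ wx wy → p * wy + q * wx) (x+y≡0⇒x≡y wx+pu≡0) (x+y≡0⇒x≡y wy+qu≡0) ⟩
      p * (q * u) + q * (p * u)   ≡⟨ solve 3 (λ p q u → p :* (q :* u) :+ q :* (p :* u) := :0) refl p q u ⟩
      0#                          ∎)
    where
      f1≡0 : f1 F c (wx + p * u) (wy + q * u) ≡ 0#
      f1≡0 = begin
        f1 F c (wx + p * u) (wy + q * u)        ≡⟨ f1-+ c wx wy (p * u) (q * u) ⟩
        f1 F c wx wy + f1 F c (p * u) (q * u)   ≡⟨ cong₂ _+_ f1w≡0 (on-line u) ⟩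
        0# + 0#                                 ≡⟨ +-identityʳ 0# ⟩
        0#                                      ∎
      f2≡0 : f2 F c (wx + p * u) (wy + q * u) ≡ 0#
      f2≡0 = begin
        f2 F c (wx + p * u) (wy + q * u)        ≡⟨ f2-+-b2≡0 c b2≡0 wx wy (p * u) (q * u) ⟩
        f2 F c wx wy + f2 F c (p * u) (q * u)   ≡⟨ cong (f2 F c wx wy +_) (trans (f2-on-line c b2≡0 p q u) hits) ⟩
        f2 F c wx wy + f2 F c wx wy             ≡⟨ x+x≡0 _ ⟩
        0#                                      ∎

  f1-0-0 : ∀ c → f1 F c 0# 0# ≡ 0#
  f1-0-0 (coeffs a1 a3 a4 a5 _ _ _ _ _) = solve 4 (λ a1 a3 a4 a5 →
    a1 :* (:0 :* :0) :+ a3 :* (:0 :* :0) :+ a4 :* :0 :+ a5 :* :0 := :0) refl a1 a3 a4 a5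

  f2-0-0 : ∀ c → f2 F c 0# 0# ≡ 0#
  f2-0-0 (coeffs _ _ _ _ b1 b2 b3 b4 b5) = solve 5 (λ b1 b2 b3 b4 b5 →
    b1 :* (:0 :* :0) :+ b2 :* (:0 :* :0) :+ b3 :* (:0 :* :0) :+ b4 :* :0 :+ b5 :* :0 := :0) refl b1 b2 b3 b4 b5

  isPermutation⇒injective : ∀ {c} → IsPermutation F c → ∀ {x y x′ y′} →
    f1 F c x y ≡ f1 F c x′ y′ → f2 F c x y ≡ f2 F c x′ y′ → x ≡ x′ × y ≡ y′
  isPermutation⇒injective {c} perm {x} {y} {x′} {y′} f1≡ f2≡ =
    let _ , _ , unique = perm (f1 F c x y) (f2 F c x y)
        x≡ , y≡ = unique x y refl refl
        x′≡ , y′≡ = unique x′ y′ (sym f1≡) (sym f2≡)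
    in trans x≡ (sym x′≡) , trans y≡ (sym y′≡)

  isPermutation⇒trivialKernel : ∀ {c} → IsPermutation F c → TrivialKernel c
  isPermutation⇒trivialKernel {c} perm x y f1≡0 f2≡0 =
    isPermutation⇒injective perm (trans f1≡0 (sym (f1-0-0 c))) (trans f2≡0 (sym (f2-0-0 c)))

  f1-nonzeroRoot : ∀ c → ∃₂ λ h k → ¬ (h ≡ 0# × k ≡ 0#) × f1 F c h k ≡ 0#
  f1-nonzeroRoot (coeffs a1 a3 a4 a5 _ _ _ _ _) with linearised-nonzeroRoot⊎hits a1 a4 (a3 + a5)
  ... | inj₁ (t , t≢0 , root) = t , 0# , t≢0 ∘ proj₁ , trans (solve 5 (λ a1 a3 a4 a5 t →
          a1 :* (t :* t) :+ a3 :* (:0 :* :0) :+ a4 :* t :+ a5 :* :0 := a1 :* (t :* t) :+ a4 :* t)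
          refl a1 a3 a4 a5 t) root
  ... | inj₂ (t , hits) = t , 1# , 1≢0 ∘ proj₂ , trans (solve 5 (λ a1 a3 a4 a5 t →
          a1 :* (t :* t) :+ a3 :* (:1 :* :1) :+ a4 :* t :+ a5 :* :1 := (a1 :* (t :* t) :+ a4 :* t) :+ (a3 :+ a5))
          refl a1 a3 a4 a5 t) (x≡y⇒x+y≡0 hits)

  nonzeroLinearForm-surjective : ∀ {h k} → ¬ (h ≡ 0# × k ≡ 0#) → ∀ w → ∃₂ λ x y → x * k + h * y ≡ w
  nonzeroLinearForm-surjective {h} {k} hk≢0 w with k ≟ 0# | h ≟ 0#
  ... | no k≢0 | _ = w * k ⁻¹ , 0# , (begin
    w * k ⁻¹ * k + h * 0#    ≡⟨ solve 4 (λ w k k⁻¹ h → w :* k⁻¹ :* k :+ h :* :0 := k :* (w :* k⁻¹)) refl w k (k ⁻¹) h ⟩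
    k * (w * k ⁻¹)           ≡⟨ x*[y*x⁻¹]≡y k≢0 w ⟩
    w                        ∎)
  ... | yes _ | no h≢0 = 0# , w * h ⁻¹ , (begin
    0# * k + h * (w * h ⁻¹)  ≡⟨ solve 4 (λ w k h h⁻¹ → :0 :* k :+ h :* (w :* h⁻¹) := h :* (w :* h⁻¹)) refl w k h (h ⁻¹) ⟩
    h * (w * h ⁻¹)           ≡⟨ x*[y*x⁻¹]≡y h≢0 w ⟩
    w                        ∎)
  ... | yes k≡0 | yes h≡0 = contradiction (h≡0 , k≡0) hk≢0


  shift-preserves-values : ∀ c {x y h k} → f1 F c h k ≡ 0# → Coeffs.b2 c * (x * k + h * y) ≡ f2 F c h k →
    f1 F c (x + h) (y + k) ≡ f1 F c x y × f2 F c (x + h) (y + k) ≡ f2 F c x y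
  shift-preserves-values c {x} {y} {h} {k} f1hk≡0 b2[xk+hy]≡r = (begin
    f1 F c (x + h) (y + k)        ≡⟨ f1-+ c x y h k ⟩
    f1 F c x y + f1 F c h k       ≡⟨ cong (f1 F c x y +_) f1hk≡0 ⟩
    f1 F c x y + 0#               ≡⟨ +-identityʳ _ ⟩
    f1 F c x y                    ∎) , (begin
    f2 F c (x + h) (y + k)        ≡⟨ f2-+ c x y h k ⟩
    f2 F c x y + r + Coeffs.b2 c * (x * k + h * y)  ≡⟨ cong (f2 F c x y + r +_) b2[xk+hy]≡r ⟩
    f2 F c x y + r + r            ≡⟨ +-assoc _ r r ⟩
    f2 F c x y + (r + r)          ≡⟨ cong (f2 F c x y +_) (x+x≡0 r) ⟩
    f2 F c x y + 0#               ≡⟨ +-identityʳ _ ⟩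
    f2 F c x y                    ∎)
    where r = f2 F c h k


  b2≢0⇒¬isPermutation : ∀ c → Coeffs.b2 c ≢ 0# → ¬ IsPermutation F c
  b2≢0⇒¬isPermutation c b2≢0 perm =
    let h , k , hk≢0 , f1hk≡0 = f1-nonzeroRoot c
        x , y , xk+hy≡r/b2 = nonzeroLinearForm-surjective hk≢0 (f2 F c h k * b2 ⁻¹)
        f1≡ , f2≡ = shift-preserves-values c f1hk≡0
                      (trans (cong (b2 *_) xk+hy≡r/b2) (x*[y*x⁻¹]≡y b2≢0 (f2 F c h k)))
        x+h≡x , y+k≡y = isPermutation⇒injective perm f1≡ f2≡
    in hk≢0 (x+h≡x⇒h≡0 x+h≡x , x+h≡x⇒h≡0 y+k≡y)
    where b2 = Coeffs.b2 c

  isPermutation⇒b2≡0 : ∀ {c} → IsPermutation F c → Coeffs.b2 c ≡ 0#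
  isPermutation⇒b2≡0 {c} perm with Coeffs.b2 c ≟ 0#
  ... | yes b2≡0 = b2≡0
  ... | no b2≢0 = contradiction perm (b2≢0⇒¬isPermutation c b2≢0)

  trivialKernel⇒injective : ∀ c → Coeffs.b2 c ≡ 0# → TrivialKernel c → ∀ {x y x′ y′} →
    f1 F c x y ≡ f1 F c x′ y′ → f2 F c x y ≡ f2 F c x′ y′ → x ≡ x′ × y ≡ y′
  trivialKernel⇒injective c b2≡0 triv {x} {y} {x′} {y′} f1≡ f2≡ =
    let x+x′≡0 , y+y′≡0 = triv (x + x′) (y + y′) (trans (f1-+ c x y x′ y′) (x≡y⇒x+y≡0 f1≡))
                                                 (trans (f2-+-b2≡0 c b2≡0 x y x′ y′) (x≡y⇒x+y≡0 f2≡))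
    in x+y≡0⇒x≡y x+x′≡0 , x+y≡0⇒x≡y y+y′≡0

  trivialKernel⇒isPermutation : ∀ c → Coeffs.b2 c ≡ 0# → TrivialKernel c → IsPermutation F c
  trivialKernel⇒isPermutation c b2≡0 triv u v =
    preimage , (cong proj₁ maps-to , cong proj₂ maps-to) ,
    λ x′ y′ f1≡u f2≡v → injective (trans f1≡u (sym (cong proj₁ maps-to))) (trans f2≡v (sym (cong proj₂ maps-to)))
    where
      system : Carrier × Carrier → Carrier × Carrier
      system (x , y) = f1 F c x y , f2 F c x y
      injective = trivialKernel⇒injective c b2≡0 triv
      system-injective : Injective _≡_ _≡_ system
      system-injective {x , y} {x′ , y′} e =
        let x≡x′ , y≡y′ = injective (cong proj₁ e) (cong proj₂ e) in cong₂ _,_ x≡x′ y≡y′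
      Carrier²↔Fin : (Carrier × Carrier) ↔ Fin (length elements ℕ.* length elements)
      Carrier²↔Fin = ↔-trans (Carrier↔Fin ×-↔ Carrier↔Fin) (↔-sym *↔×)
      surjective = injective⇒surjective Carrier²↔Fin system system-injective (u , v)
      preimage = proj₁ surjective
      maps-to = proj₂ surjective

  f1-swapXY : ∀ c x y → f1 F (swapXY c) y x ≡ f1 F c x y
  f1-swapXY (coeffs a1 a3 a4 a5 _ _ _ _ _) = solve 6 (λ a1 a3 a4 a5 x y →
    a3 :* (y :* y) :+ a1 :* (x :* x) :+ a5 :* y :+ a4 :* x
    := a1 :* (x :* x) :+ a3 :* (y :* y) :+ a4 :* x :+ a5 :* y) refl a1 a3 a4 a5

  f2-swapXY : ∀ c x y → f2 F (swapXY c) y x ≡ f2 F c x y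
  f2-swapXY (coeffs _ _ _ _ b1 b2 b3 b4 b5) = solve 7 (λ b1 b2 b3 b4 b5 x y →
    b3 :* (y :* y) :+ b2 :* (y :* x) :+ b1 :* (x :* x) :+ b5 :* y :+ b4 :* x
    := b1 :* (x :* x) :+ b2 :* (x :* y) :+ b3 :* (y :* y) :+ b4 :* x :+ b5 :* y) refl b1 b2 b3 b4 b5

  trivialKernel-swapXY : ∀ c → TrivialKernel (swapXY c) → TrivialKernel c
  trivialKernel-swapXY c triv x y f1≡0 f2≡0 =
    swap (triv y x (trans (f1-swapXY c x y) f1≡0) (trans (f2-swapXY c x y) f2≡0))

  trivialKernel-xAxis : ∀ c → Coeffs.b2 c ≡ 0# →
    (∀ x → f1 F c x 0# ≡ 0#) → (∀ x y → f1 F c x y ≡ 0# → y ≡ 0#) →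
    TrivialKernel c ⇔ ExactlyOne (Coeffs.b1 c ≡ 0#) (Coeffs.b4 c ≡ 0#)
  trivialKernel-xAxis c b2≡0 on-axis on-axis⁻¹ = trivialKernel-line c b2≡0 1# 0# 1≢0
    (λ v → trans (cong₂ (f1 F c) (*-identityˡ v) (zeroˡ v)) (on-axis v))
    (λ x y f1≡0 → trans (zeroˡ x) (sym (trans (*-identityˡ y) (on-axis⁻¹ x y f1≡0))))
    (solve 2 (λ b1 b3 → b1 :* (:1 :* :1) :+ b3 :* (:0 :* :0) := b1) refl (Coeffs.b1 c) (Coeffs.b3 c))
    (solve 2 (λ b4 b5 → b4 :* :1 :+ b5 :* :0 := b4) refl (Coeffs.b4 c) (Coeffs.b5 c))

  trivialKernel-case1 : ∀ {a5} b1 b3 b4 b5 → a5 ≢ 0# →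
    TrivialKernel (coeffs 0# 0# 0# a5 b1 0# b3 b4 b5) ⇔ ExactlyOne (b1 ≡ 0#) (b4 ≡ 0#)
  trivialKernel-case1 {a5} b1 b3 b4 b5 a5≢0 = trivialKernel-xAxis _ refl
    (λ x → solve 2 (λ a5 x → :0 :* (x :* x) :+ :0 :* (:0 :* :0) :+ :0 :* x :+ a5 :* :0 := :0) refl a5 x)
    (λ x y f1≡0 → *-cancelˡ-≡0 a5≢0 (trans (solve 3 (λ a5 x y →
      a5 :* y := :0 :* (x :* x) :+ :0 :* (y :* y) :+ :0 :* x :+ a5 :* y) refl a5 x y) f1≡0))

  trivialKernel-case3 : ∀ {a3} b1 b3 b4 b5 → a3 ≢ 0# →
    TrivialKernel (coeffs 0# a3 0# 0# b1 0# b3 b4 b5) ⇔ ExactlyOne (b1 ≡ 0#) (b4 ≡ 0#)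
  trivialKernel-case3 {a3} b1 b3 b4 b5 a3≢0 = trivialKernel-xAxis _ refl
    (λ x → solve 2 (λ a3 x → :0 :* (x :* x) :+ a3 :* (:0 :* :0) :+ :0 :* x :+ :0 :* :0 := :0) refl a3 x)
    (λ x y f1≡0 → x*x≡0⇒x≡0 (*-cancelˡ-≡0 a3≢0 (trans (solve 3 (λ a3 x y →
      a3 :* (y :* y) := :0 :* (x :* x) :+ a3 :* (y :* y) :+ :0 :* x :+ :0 :* y) refl a3 x y) f1≡0)))

  trivialKernel-case2 : ∀ {a4 a5} b1 b3 b4 b5 → a4 ≢ 0# → a5 ≢ 0# →
    TrivialKernel (coeffs 0# 0# a4 a5 b1 0# b3 b4 b5) ⇔
    ExactlyOne (a4 * b5 + a5 * b4 ≡ 0#) (sq F a5 * b1 + sq F a4 * b3 ≡ 0#)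
  trivialKernel-case2 {a4} {a5} b1 b3 b4 b5 a4≢0 a5≢0 = ⇔-trans
    (trivialKernel-line _ refl a5 a4 a5≢0
      (solve 3 (λ a4 a5 v → :0 :* ((a5 :* v) :* (a5 :* v)) :+ :0 :* ((a4 :* v) :* (a4 :* v))
                            :+ a4 :* (a5 :* v) :+ a5 :* (a4 :* v) := :0) refl a4 a5)
      (λ x y f1≡0 → x+y≡0⇒x≡y (trans (solve 4 (λ a4 a5 x y →
        a4 :* x :+ a5 :* y := :0 :* (x :* x) :+ :0 :* (y :* y) :+ a4 :* x :+ a5 :* y) refl a4 a5 x y) f1≡0))
      (solve 4 (λ a4 a5 b1 b3 → b1 :* (a5 :* a5) :+ b3 :* (a4 :* a4) := a5 :* a5 :* b1 :+ a4 :* a4 :* b3)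
               refl a4 a5 b1 b3)
      (solve 4 (λ a4 a5 b4 b5 → b4 :* a5 :+ b5 :* a4 := a4 :* b5 :+ a5 :* b4) refl a4 a5 b4 b5))
    (mk⇔ exactlyOne-swap exactlyOne-swap)

  trivialKernel-case5-squares : ∀ {s1 s3} b1 b3 b4 b5 → s3 ≢ 0# →
    TrivialKernel (coeffs (s1 * s1) (s3 * s3) 0# 0# b1 0# b3 b4 b5) ⇔
    ExactlyOne ((s1 * s1) * b3 + (s3 * s3) * b1 ≡ 0#) (s1 * b5 + s3 * b4 ≡ 0#)
  trivialKernel-case5-squares {s1} {s3} b1 b3 b4 b5 s3≢0 = trivialKernel-line _ refl s3 s1 s3≢0
    (solve 3 (λ s1 s3 v → s1 :* s1 :* ((s3 :* v) :* (s3 :* v)) :+ s3 :* s3 :* ((s1 :* v) :* (s1 :* v))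
                          :+ :0 :* (s3 :* v) :+ :0 :* (s1 :* v) := :0) refl s1 s3)
    (λ x y f1≡0 → x+y≡0⇒x≡y (x*x≡0⇒x≡0 (trans (solve 4 (λ s1 s3 x y →
      (s1 :* x :+ s3 :* y) :* (s1 :* x :+ s3 :* y)
      := s1 :* s1 :* (x :* x) :+ s3 :* s3 :* (y :* y) :+ :0 :* x :+ :0 :* y) refl s1 s3 x y) f1≡0)))
    (solve 4 (λ s1 s3 b1 b3 → b1 :* (s3 :* s3) :+ b3 :* (s1 :* s1) := s1 :* s1 :* b3 :+ s3 :* s3 :* b1)
             refl s1 s3 b1 b3)
    (solve 4 (λ s1 s3 b4 b5 → b4 :* s3 :+ b5 :* s1 := s1 :* b5 :+ s3 :* b4) refl s1 s3 b4 b5)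

  trivialKernel-case5 : ∀ {a1 a3} b1 b3 b4 b5 → a3 ≢ 0# →
    TrivialKernel (coeffs a1 a3 0# 0# b1 0# b3 b4 b5) ⇔
    ExactlyOne (a1 * b3 + a3 * b1 ≡ 0#) (√ a1 * b5 + √ a3 * b4 ≡ 0#)
  trivialKernel-case5 {a1} {a3} b1 b3 b4 b5 a3≢0 =
    subst₂ (λ A1 A3 → TrivialKernel (coeffs A1 A3 0# 0# b1 0# b3 b4 b5) ⇔
                      ExactlyOne (A1 * b3 + A3 * b1 ≡ 0#) (√ a1 * b5 + √ a3 * b4 ≡ 0#))
      (√c*√c≡c a1) (√c*√c≡c a3) (trivialKernel-case5-squares b1 b3 b4 b5 (√≢0 a3≢0))

  quartic : Carrier → Carrier → Carrier → Carrier → Carrier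
  quartic d1 d2 d3 z = d1 * sq F (sq F z) + d2 * sq F z + d3 * z

  graphParametrisation : ∀ c (g : Carrier → Carrier) → g 0# ≡ 0# →
    (∀ y → f1 F c (g y) y ≡ 0#) → (∀ x y → f1 F c x y ≡ 0# → g y ≡ x) → ZeroSetParametrisation c
  graphParametrisation c g g0≡0 on-graph on-graph⁻¹ = record
    { φx = g
    ; φy = λ y → y
    ; on-zero-set = on-graph
    ; covers = λ x y f1≡0 → y , on-graph⁻¹ x y f1≡0 , refl
    ; origin-fibre = λ _ _ y≡0 → y≡0
    ; φx-0 = g0≡0
    ; φy-0 = refl
    }

  ⁻¹-sq : ∀ {a} → a ≢ 0# → (a * a) ⁻¹ ≡ a ⁻¹ * a ⁻¹
  ⁻¹-sq {a} a≢0 = ⁻¹-unique (begin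
    (a * a) * (a ⁻¹ * a ⁻¹)      ≡⟨ solve 2 (λ a a⁻¹ → (a :* a) :* (a⁻¹ :* a⁻¹) := a :* a⁻¹ :* (a :* a⁻¹)) refl a (a ⁻¹) ⟩
    a * a ⁻¹ * (a * a ⁻¹)        ≡⟨ x*x⁻¹*y≡y a≢0 _ ⟩
    a * a ⁻¹                     ≡⟨ x*x⁻¹≡1 a≢0 ⟩
    1#                           ∎)

  L₁-on-graph : ∀ {a3 a4 a5} b1 b3 b4 b5 → a4 ≢ 0# → ∀ y →
    f2 F (coeffs 0# a3 a4 a5 b1 0# b3 b4 b5) ((a3 * (y * y) + a5 * y) * a4 ⁻¹) y ≡
    quartic ((b1 * (a3 * a3)) * (a4 * a4) ⁻¹) (b3 + (b1 * (a5 * a5)) * (a4 * a4) ⁻¹ + (b4 * a3) * a4 ⁻¹)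
            ((b4 * a5) * a4 ⁻¹ + b5) y
  L₁-on-graph {a3} {a4} {a5} b1 b3 b4 b5 a4≢0 y = begin
    f2 F (coeffs 0# a3 a4 a5 b1 0# b3 b4 b5) ((a3 * (y * y) + a5 * y) * a4 ⁻¹) y
      ≡⟨ solve 8 (λ a3 a5 b1 b3 b4 b5 a4⁻¹ y →
           b1 :* (((a3 :* (y :* y) :+ a5 :* y) :* a4⁻¹) :* ((a3 :* (y :* y) :+ a5 :* y) :* a4⁻¹))
             :+ :0 :* (((a3 :* (y :* y) :+ a5 :* y) :* a4⁻¹) :* y)
             :+ b3 :* (y :* y) :+ b4 :* ((a3 :* (y :* y) :+ a5 :* y) :* a4⁻¹) :+ b5 :* y
           := ((b1 :* (a3 :* a3)) :* (a4⁻¹ :* a4⁻¹)) :* ((y :* y) :* (y :* y))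
              :+ (b3 :+ (b1 :* (a5 :* a5)) :* (a4⁻¹ :* a4⁻¹) :+ (b4 :* a3) :* a4⁻¹) :* (y :* y)
              :+ ((b4 :* a5) :* a4⁻¹ :+ b5) :* y) refl a3 a5 b1 b3 b4 b5 (a4 ⁻¹) y ⟩
    quartic ((b1 * (a3 * a3)) * (a4 ⁻¹ * a4 ⁻¹)) (b3 + (b1 * (a5 * a5)) * (a4 ⁻¹ * a4 ⁻¹) + (b4 * a3) * a4 ⁻¹)
            ((b4 * a5) * a4 ⁻¹ + b5) y
      ≡⟨ cong (λ i → quartic ((b1 * (a3 * a3)) * i) (b3 + (b1 * (a5 * a5)) * i + (b4 * a3) * a4 ⁻¹)
                             ((b4 * a5) * a4 ⁻¹ + b5) y) (⁻¹-sq a4≢0) ⟨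
    quartic ((b1 * (a3 * a3)) * (a4 * a4) ⁻¹) (b3 + (b1 * (a5 * a5)) * (a4 * a4) ⁻¹ + (b4 * a3) * a4 ⁻¹)
            ((b4 * a5) * a4 ⁻¹ + b5) y ∎

  trivialKernel-case4 : ∀ {a3 a4 a5} b1 b3 b4 b5 → a4 ≢ 0# →
    TrivialKernel (coeffs 0# a3 a4 a5 b1 0# b3 b4 b5) ⇔
    OnlyRootZero F ((b1 * (a3 * a3)) * (a4 * a4) ⁻¹)
                   (b3 + (b1 * (a5 * a5)) * (a4 * a4) ⁻¹ + (b4 * a3) * a4 ⁻¹)
                   ((b4 * a5) * a4 ⁻¹ + b5)
  trivialKernel-case4 {a3} {a4} {a5} b1 b3 b4 b5 a4≢0 =
    ⇔-trans (trivialKernel⇔trivialRoots (graphParametrisation c g g0≡0 on-graph on-graph⁻¹))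
            (trivialRoots-cong (L₁-on-graph b1 b3 b4 b5 a4≢0))
    where
      c = coeffs 0# a3 a4 a5 b1 0# b3 b4 b5
      g : Carrier → Carrier
      g y = (a3 * (y * y) + a5 * y) * a4 ⁻¹
      g0≡0 : g 0# ≡ 0#
      g0≡0 = solve 3 (λ a3 a5 a4⁻¹ → (a3 :* (:0 :* :0) :+ a5 :* :0) :* a4⁻¹ := :0) refl a3 a5 (a4 ⁻¹)
      on-graph : ∀ y → f1 F c (g y) y ≡ 0#
      on-graph y = begin
        f1 F c (g y) y
          ≡⟨ solve 5 (λ a3 a4 a5 a4⁻¹ y →
               :0 :* (((a3 :* (y :* y) :+ a5 :* y) :* a4⁻¹) :* ((a3 :* (y :* y) :+ a5 :* y) :* a4⁻¹))
               :+ a3 :* (y :* y) :+ a4 :* ((a3 :* (y :* y) :+ a5 :* y) :* a4⁻¹) :+ a5 :* y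
               := a4 :* a4⁻¹ :* (a3 :* (y :* y) :+ a5 :* y) :+ (a3 :* (y :* y) :+ a5 :* y))
               refl a3 a4 a5 (a4 ⁻¹) y ⟩
        a4 * a4 ⁻¹ * e + e       ≡⟨ cong (_+ e) (x*x⁻¹*y≡y a4≢0 e) ⟩
        e + e                    ≡⟨ x+x≡0 e ⟩
        0#                       ∎
        where e = a3 * (y * y) + a5 * y
      on-graph⁻¹ : ∀ x y → f1 F c x y ≡ 0# → g y ≡ x
      on-graph⁻¹ x y f1≡0 = begin
        (a3 * (y * y) + a5 * y) * a4 ⁻¹   ≡⟨ cong (_* a4 ⁻¹) (x+y≡0⇒x≡y (trans (solve 5 (λ a3 a4 a5 x y →
                                               a3 :* (y :* y) :+ a5 :* y :+ a4 :* x
                                               := :0 :* (x :* x) :+ a3 :* (y :* y) :+ a4 :* x :+ a5 :* y)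
                                               refl a3 a4 a5 x y) f1≡0)) ⟩
        a4 * x * a4 ⁻¹                    ≡⟨ solve 3 (λ a4 x a4⁻¹ → a4 :* x :* a4⁻¹ := a4 :* a4⁻¹ :* x) refl a4 x (a4 ⁻¹) ⟩
        a4 * a4 ⁻¹ * x                    ≡⟨ x*x⁻¹*y≡y a4≢0 x ⟩
        x                                 ∎

  parabola-covers : ∀ {s1 s3 a4 a5 x y} → a4 * s3 + a5 * s1 ≢ 0# →
    s1 * s1 * (x * x) + s3 * s3 * (y * y) + a4 * x + a5 * y ≡ 0# →
    let D = a4 * s3 + a5 * s1 ; v = (s1 * x + s3 * y) * D ⁻¹ in
    s3 * D * (v * v) + a5 * v ≡ x × s1 * D * (v * v) + a4 * v ≡ y
  parabola-covers {s1} {s3} {a4} {a5} {x} {y} D≢0 f1≡0 =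
    *-cancelˡ-≡ D≢0 (trans (Dφ≡ s3 a5) (solve 6 (λ s1 s3 a4 a5 x y →
      s3 :* (a4 :* x :+ a5 :* y) :+ a5 :* (s1 :* x :+ s3 :* y) := (a4 :* s3 :+ a5 :* s1) :* x) refl s1 s3 a4 a5 x y)) ,
    *-cancelˡ-≡ D≢0 (trans (Dφ≡ s1 a4) (solve 6 (λ s1 s3 a4 a5 x y →
      s1 :* (a4 :* x :+ a5 :* y) :+ a4 :* (s1 :* x :+ s3 :* y) := (a4 :* s3 :+ a5 :* s1) :* y) refl s1 s3 a4 a5 x y))
    where
      D = a4 * s3 + a5 * s1
      w = s1 * x + s3 * y
      v = w * D ⁻¹
      w²≡a4x+a5y : w * w ≡ a4 * x + a5 * y
      w²≡a4x+a5y = x+y≡0⇒x≡y (trans (solve 6 (λ s1 s3 a4 a5 x y →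
        (s1 :* x :+ s3 :* y) :* (s1 :* x :+ s3 :* y) :+ (a4 :* x :+ a5 :* y)
        := s1 :* s1 :* (x :* x) :+ s3 :* s3 :* (y :* y) :+ a4 :* x :+ a5 :* y) refl s1 s3 a4 a5 x y) f1≡0)
      Dφ≡ : ∀ σ α → D * (σ * D * (v * v) + α * v) ≡ σ * (a4 * x + a5 * y) + α * w
      Dφ≡ σ α = begin
        D * (σ * D * (v * v) + α * v)      ≡⟨ solve 4 (λ σ α D v → D :* (σ :* D :* (v :* v) :+ α :* v)
                                                := σ :* ((D :* v) :* (D :* v)) :+ α :* (D :* v)) refl σ α D v ⟩
        σ * ((D * v) * (D * v)) + α * (D * v) ≡⟨ cong (λ t → σ * (t * t) + α * t) (x*[y*x⁻¹]≡y D≢0 w) ⟩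
        σ * (w * w) + α * w                ≡⟨ cong (λ t → σ * t + α * w) w²≡a4x+a5y ⟩
        σ * (a4 * x + a5 * y) + α * w      ∎

  -- Writing w = s1 x + s3 y, the zero set is w² = a4 x + a5 y; solving this together with w = D v
  -- gives x = s3 D v² + a5 v and y = s1 D v² + a4 v.
  parabolaParametrisation : ∀ s1 s3 a4 a5 {b1 b2 b3 b4 b5} → a4 * s3 + a5 * s1 ≢ 0# →
    ZeroSetParametrisation (coeffs (s1 * s1) (s3 * s3) a4 a5 b1 b2 b3 b4 b5)
  parabolaParametrisation s1 s3 a4 a5 D≢0 = record
    { φx = φ s3 a5
    ; φy = φ s1 a4
    ; on-zero-set = solve 5 (λ s1 s3 a4 a5 v →
        s1 :* s1 :* ((s3 :* (a4 :* s3 :+ a5 :* s1) :* (v :* v) :+ a5 :* v) :* (s3 :* (a4 :* s3 :+ a5 :* s1) :* (v :* v) :+ a5 :* v))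
        :+ s3 :* s3 :* ((s1 :* (a4 :* s3 :+ a5 :* s1) :* (v :* v) :+ a4 :* v) :* (s1 :* (a4 :* s3 :+ a5 :* s1) :* (v :* v) :+ a4 :* v))
        :+ a4 :* (s3 :* (a4 :* s3 :+ a5 :* s1) :* (v :* v) :+ a5 :* v)
        :+ a5 :* (s1 :* (a4 :* s3 :+ a5 :* s1) :* (v :* v) :+ a4 :* v) := :0) refl s1 s3 a4 a5
    ; covers = λ x y f1≡0 → _ , parabola-covers D≢0 f1≡0
    ; origin-fibre = λ v φxv≡0 φyv≡0 → *-cancelˡ-≡0 D≢0 (begin
        D * v                           ≡⟨ solve 6 (λ s1 s3 a4 a5 D v →
                                             (a4 :* s3 :+ a5 :* s1) :* v
                                             := s1 :* (s3 :* D :* (v :* v) :+ a5 :* v) :+ s3 :* (s1 :* D :* (v :* v) :+ a4 :* v))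
                                             refl s1 s3 a4 a5 D v ⟩
        s1 * φ s3 a5 v + s3 * φ s1 a4 v ≡⟨ cong₂ (λ X Y → s1 * X + s3 * Y) φxv≡0 φyv≡0 ⟩
        s1 * 0# + s3 * 0#               ≡⟨ solve 2 (λ s1 s3 → s1 :* :0 :+ s3 :* :0 := :0) refl s1 s3 ⟩
        0#                              ∎)
    ; φx-0 = φ-0 s3 a5
    ; φy-0 = φ-0 s1 a4
    }
    where
      D = a4 * s3 + a5 * s1
      φ : Carrier → Carrier → Carrier → Carrier
      φ σ α v = σ * D * (v * v) + α * v
      φ-0 : ∀ σ α → φ σ α 0# ≡ 0#
      φ-0 σ α = solve 3 (λ σ α D → σ :* D :* (:0 :* :0) :+ α :* :0 := :0) refl σ α D

  f2-on-parabola-rescaled : ∀ s1 s3 k D a4 a5 b1 b3 b4 b5 v →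
    quartic ((s1 * s1 * b3 + s3 * s3 * b1) * (k * k))
            ((b1 * (a5 * a5) + b3 * (a4 * a4)) * (k * k) + (D * k) * ((b4 * s3 + b5 * s1) * k))
            ((D * k) * ((a4 * b5) * k + (a5 * b4) * k)) (D * v)
    ≡ (D * k) * (D * k) * f2 F (coeffs (s1 * s1) (s3 * s3) a4 a5 b1 0# b3 b4 b5)
                               (s3 * D * (v * v) + a5 * v) (s1 * D * (v * v) + a4 * v)
  f2-on-parabola-rescaled = solve 11 (λ s1 s3 k D a4 a5 b1 b3 b4 b5 v →
    ((s1 :* s1 :* b3 :+ s3 :* s3 :* b1) :* (k :* k)) :* ((D :* v) :* (D :* v) :* ((D :* v) :* (D :* v)))
    :+ ((b1 :* (a5 :* a5) :+ b3 :* (a4 :* a4)) :* (k :* k) :+ (D :* k) :* ((b4 :* s3 :+ b5 :* s1) :* k))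
       :* ((D :* v) :* (D :* v))
    :+ ((D :* k) :* ((a4 :* b5) :* k :+ (a5 :* b4) :* k)) :* (D :* v)
    := (D :* k) :* (D :* k) :* (b1 :* ((s3 :* D :* (v :* v) :+ a5 :* v) :* (s3 :* D :* (v :* v) :+ a5 :* v))
       :+ :0 :* ((s3 :* D :* (v :* v) :+ a5 :* v) :* (s1 :* D :* (v :* v) :+ a4 :* v))
       :+ b3 :* ((s1 :* D :* (v :* v) :+ a4 :* v) :* (s1 :* D :* (v :* v) :+ a4 :* v))
       :+ b4 :* (s3 :* D :* (v :* v) :+ a5 :* v) :+ b5 :* (s1 :* D :* (v :* v) :+ a4 :* v))) refl

  fraction-sum : ∀ {s1 s3 J1 J3} → s1 * J1 ≡ 1# → s3 * J3 ≡ 1# →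
    ∀ X Y → X * J1 + Y * J3 ≡ (X * s3 + Y * s1) * (J1 * J3)
  fraction-sum {s1} {s3} {J1} {J3} s1J1≡1 s3J3≡1 X Y = sym (begin
    (X * s3 + Y * s1) * (J1 * J3)            ≡⟨ solve 6 (λ X Y s1 s3 J1 J3 → (X :* s3 :+ Y :* s1) :* (J1 :* J3)
                                                  := X :* (s3 :* J3) :* J1 :+ Y :* (s1 :* J1) :* J3) refl X Y s1 s3 J1 J3 ⟩
    X * (s3 * J3) * J1 + Y * (s1 * J1) * J3  ≡⟨ cong₂ (λ u t → X * u * J1 + Y * t * J3) s3J3≡1 s1J1≡1 ⟩
    X * 1# * J1 + Y * 1# * J3                ≡⟨ cong₂ (λ u t → u * J1 + t * J3) (*-identityʳ X) (*-identityʳ Y) ⟩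
    X * J1 + Y * J3                          ∎)

  L₂-on-parabola : ∀ {s1 s3 J1 J3 K R} a4 a5 b1 b3 b4 b5 → s1 * J1 ≡ 1# → s3 * J3 ≡ 1# →
    K ≡ (J1 * J3) * (J1 * J3) → R ≡ J1 * J3 → let D = a4 * s3 + a5 * s1 ; k = J1 * J3 in ∀ v →
    quartic ((s1 * s1 * b3 + s3 * s3 * b1) * K)
            ((b1 * (a5 * a5) + b3 * (a4 * a4)) * K + (a5 * J3 + a4 * J1) * (b4 * J1 + b5 * J3))
            ((a4 * J1 + a5 * J3) * ((a4 * b5) * R + (a5 * b4) * R)) (D * v)
    ≡ (D * k) * (D * k) * f2 F (coeffs (s1 * s1) (s3 * s3) a4 a5 b1 0# b3 b4 b5)
                               (s3 * D * (v * v) + a5 * v) (s1 * D * (v * v) + a4 * v)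
  L₂-on-parabola {s1} {s3} {J1} {J3} a4 a5 b1 b3 b4 b5 s1J1≡1 s3J3≡1 refl refl v = begin
    L (a5 * J3 + a4 * J1) (b4 * J1 + b5 * J3) (a4 * J1 + a5 * J3)
      ≡⟨ cong₂ (λ X Z → L X (b4 * J1 + b5 * J3) Z) (trans (+-comm _ _) (over-k a4 a5)) (over-k a4 a5) ⟩
    L (D * k) (b4 * J1 + b5 * J3) (D * k)
      ≡⟨ cong (λ Y → L (D * k) Y (D * k)) (over-k b4 b5) ⟩
    L (D * k) ((b4 * s3 + b5 * s1) * k) (D * k)
      ≡⟨ f2-on-parabola-rescaled s1 s3 k D a4 a5 b1 b3 b4 b5 v ⟩
    (D * k) * (D * k) * f2 F (coeffs (s1 * s1) (s3 * s3) a4 a5 b1 0# b3 b4 b5)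
                             (s3 * D * (v * v) + a5 * v) (s1 * D * (v * v) + a4 * v) ∎
    where
      D = a4 * s3 + a5 * s1
      k = J1 * J3
      over-k = fraction-sum s1J1≡1 s3J3≡1
      L : Carrier → Carrier → Carrier → Carrier
      L X Y Z = quartic ((s1 * s1 * b3 + s3 * s3 * b1) * (k * k)) ((b1 * (a5 * a5) + b3 * (a4 * a4)) * (k * k) + X * Y)
                        (Z * ((a4 * b5) * k + (a5 * b4) * k)) (D * v)

  trivialKernel-case6-general : ∀ {a1 a3 s1 s3 J1 J3 K R} a4 a5 b1 b3 b4 b5 →
    s1 * s1 ≡ a1 → s3 * s3 ≡ a3 → s1 * J1 ≡ 1# → s3 * J3 ≡ 1# →
    (a1 * a3) * K ≡ 1# → (s1 * s3) * R ≡ 1# → s1 * a5 ≢ s3 * a4 →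
    TrivialKernel (coeffs a1 a3 a4 a5 b1 0# b3 b4 b5) ⇔
    OnlyRootZero F ((a1 * b3 + a3 * b1) * K)
                   ((b1 * (a5 * a5) + b3 * (a4 * a4)) * K + (a5 * J3 + a4 * J1) * (b4 * J1 + b5 * J3))
                   ((a4 * J1 + a5 * J3) * ((a4 * b5) * R + (a5 * b4) * R))
  trivialKernel-case6-general {s1 = s1} {s3} {J1} {J3} a4 a5 b1 b3 b4 b5
    refl refl s1J1≡1 s3J3≡1 K-inverse R-inverse s1a5≢s3a4 =
    ⇔-trans (trivialKernel⇔trivialRoots (parabolaParametrisation s1 s3 a4 a5 D≢0))
            (trivialRoots-rescale D≢0 (x*y≢0 Dk≢0 Dk≢0)
              (L₂-on-parabola a4 a5 b1 b3 b4 b5 s1J1≡1 s3J3≡1 K≡k² (inverse-unique R-inverse [s1s3]k≡1)))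
    where
      D = a4 * s3 + a5 * s1
      k = J1 * J3
      D≢0 : D ≢ 0#
      D≢0 D≡0 = s1a5≢s3a4 (trans (*-comm s1 a5) (trans (sym (x+y≡0⇒x≡y D≡0)) (*-comm a4 s3)))
      [s1s3]k≡1 : (s1 * s3) * k ≡ 1#
      [s1s3]k≡1 = begin
        (s1 * s3) * (J1 * J3)   ≡⟨ solve 4 (λ s1 s3 J1 J3 → (s1 :* s3) :* (J1 :* J3) := (s1 :* J1) :* (s3 :* J3)) refl s1 s3 J1 J3 ⟩
        (s1 * J1) * (s3 * J3)   ≡⟨ cong₂ _*_ s1J1≡1 s3J3≡1 ⟩
        1# * 1#                 ≡⟨ *-identityˡ 1# ⟩
        1#                      ∎
      Dk≢0 : D * k ≢ 0#
      Dk≢0 = x*y≢0 D≢0 (x*y≡1⇒y≢0 [s1s3]k≡1)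
      K≡k² = inverse-unique K-inverse (begin
        (s1 * s1) * (s3 * s3) * (k * k)   ≡⟨ solve 3 (λ s1 s3 k → (s1 :* s1) :* (s3 :* s3) :* (k :* k) := (s1 :* s3 :* k) :* (s1 :* s3 :* k)) refl s1 s3 k ⟩
        ((s1 * s3) * k) * ((s1 * s3) * k) ≡⟨ cong₂ _*_ [s1s3]k≡1 [s1s3]k≡1 ⟩
        1# * 1#                           ≡⟨ *-identityˡ 1# ⟩
        1#                                ∎)

  trivialKernel-case6 : ∀ {a1 a3 a4 a5} b1 b3 b4 b5 → a1 ≢ 0# → a3 ≢ 0# → √ a1 * a5 ≢ √ a3 * a4 →
    TrivialKernel (coeffs a1 a3 a4 a5 b1 0# b3 b4 b5) ⇔
    OnlyRootZero F ((a1 * b3 + a3 * b1) * (a1 * a3) ⁻¹)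
                   ((b1 * (a5 * a5) + b3 * (a4 * a4)) * (a1 * a3) ⁻¹
                     + (a5 * (√ a3) ⁻¹ + a4 * (√ a1) ⁻¹) * (b4 * (√ a1) ⁻¹ + b5 * (√ a3) ⁻¹))
                   ((a4 * (√ a1) ⁻¹ + a5 * (√ a3) ⁻¹) * ((a4 * b5) * (√ (a1 * a3)) ⁻¹ + (a5 * b4) * (√ (a1 * a3)) ⁻¹))
  trivialKernel-case6 {a1} {a3} {a4} {a5} b1 b3 b4 b5 a1≢0 a3≢0 =
    trivialKernel-case6-general a4 a5 b1 b3 b4 b5 (√c*√c≡c a1) (√c*√c≡c a3)
      (x*x⁻¹≡1 (√≢0 a1≢0)) (x*x⁻¹≡1 (√≢0 a3≢0)) (x*x⁻¹≡1 a1a3≢0)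
      (subst (λ r → r * (√ (a1 * a3)) ⁻¹ ≡ 1#) √a1a3≡√a1√a3 (x*x⁻¹≡1 (√≢0 a1a3≢0)))
    where
      a1a3≢0 = x*y≢0 a1≢0 a3≢0
      √a1a3≡√a1√a3 : √ (a1 * a3) ≡ √ a1 * √ a3
      √a1a3≡√a1√a3 = √-unique (begin
        (√ a1 * √ a3) * (√ a1 * √ a3)  ≡⟨ solve 2 (λ s1 s3 → (s1 :* s3) :* (s1 :* s3) := (s1 :* s1) :* (s3 :* s3)) refl (√ a1) (√ a3) ⟩
        (√ a1 * √ a1) * (√ a3 * √ a3)  ≡⟨ cong₂ _*_ (√c*√c≡c a1) (√c*√c≡c a3) ⟩
        a1 * a3                        ∎)

  ¬trivialKernel-f1≡0 : ∀ b1 b3 b4 b5 → ¬ TrivialKernel (coeffs 0# 0# 0# 0# b1 0# b3 b4 b5)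
  ¬trivialKernel-f1≡0 b1 b3 b4 b5 = ¬trivialKernel-parallelZeroLines _ refl 1# 0# 0# 1#
    (solve 1 (λ u → :0 :* ((:1 :* u) :* (:1 :* u)) :+ :0 :* ((:0 :* u) :* (:0 :* u)) :+ :0 :* (:1 :* u) :+ :0 :* (:0 :* u) := :0) refl)
    (solve 0 (:0 :* (:0 :* :0) :+ :0 :* (:1 :* :1) :+ :0 :* :0 :+ :0 :* :1 := :0) refl)
    (λ det≡0 → 0≢1 (trans (sym det≡0) (solve 0 (:1 :* :1 :+ :0 :* :0 := :1) refl)))

  ¬trivialKernel-horizontalLinePair : ∀ {a3 a5} b1 b3 b4 b5 → a3 ≢ 0# → a5 ≢ 0# →
    ¬ TrivialKernel (coeffs 0# a3 0# a5 b1 0# b3 b4 b5)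
  ¬trivialKernel-horizontalLinePair {a3} {a5} b1 b3 b4 b5 a3≢0 a5≢0 = ¬trivialKernel-parallelZeroLines _ refl 1# 0# 0# y₀
    (solve 3 (λ a3 a5 u → :0 :* ((:1 :* u) :* (:1 :* u)) :+ a3 :* ((:0 :* u) :* (:0 :* u)) :+ :0 :* (:1 :* u)
                          :+ a5 :* (:0 :* u) := :0) refl a3 a5)
    (begin
      0# * (0# * 0#) + a3 * (y₀ * y₀) + 0# * 0# + a5 * y₀
        ≡⟨ solve 3 (λ a3 a5 a3⁻¹ → :0 :* (:0 :* :0) :+ a3 :* ((a5 :* a3⁻¹) :* (a5 :* a3⁻¹)) :+ :0 :* :0 :+ a5 :* (a5 :* a3⁻¹)
                                   := a3 :* a3⁻¹ :* (a5 :* a5 :* a3⁻¹) :+ a5 :* a5 :* a3⁻¹) refl a3 a5 (a3 ⁻¹) ⟩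
      a3 * a3 ⁻¹ * (a5 * a5 * a3 ⁻¹) + a5 * a5 * a3 ⁻¹
        ≡⟨ cong (_+ a5 * a5 * a3 ⁻¹) (x*x⁻¹*y≡y a3≢0 _) ⟩
      a5 * a5 * a3 ⁻¹ + a5 * a5 * a3 ⁻¹
        ≡⟨ x+x≡0 _ ⟩
      0# ∎)
    (λ det≡0 → x*y≢0 a5≢0 (x⁻¹≢0 a3≢0) (trans (solve 2 (λ a5 a3⁻¹ → a5 :* a3⁻¹ := :1 :* (a5 :* a3⁻¹) :+ :0 :* :0) refl a5 (a3 ⁻¹)) det≡0))
    where y₀ = a5 * a3 ⁻¹

  ¬trivialKernel-slantedLinePair-squares : ∀ {s1 s3 a4 a5} b1 b3 b4 b5 → s1 ≢ 0# → a4 ≢ 0# → s1 * a5 ≡ s3 * a4 →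
    ¬ TrivialKernel (coeffs (s1 * s1) (s3 * s3) a4 a5 b1 0# b3 b4 b5)
  ¬trivialKernel-slantedLinePair-squares {s1} {s3} {a4} {a5} b1 b3 b4 b5 s1≢0 a4≢0 s1a5≡s3a4 =
    ¬trivialKernel-parallelZeroLines _ refl s3 s1 x₀ 0#
    (λ u → begin
      s1 * s1 * ((s3 * u) * (s3 * u)) + s3 * s3 * ((s1 * u) * (s1 * u)) + a4 * (s3 * u) + a5 * (s1 * u)
        ≡⟨ solve 5 (λ s1 s3 a4 a5 u → s1 :* s1 :* ((s3 :* u) :* (s3 :* u)) :+ s3 :* s3 :* ((s1 :* u) :* (s1 :* u))
                                      :+ a4 :* (s3 :* u) :+ a5 :* (s1 :* u) := (s3 :* a4 :+ s1 :* a5) :* u) refl s1 s3 a4 a5 u ⟩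
      (s3 * a4 + s1 * a5) * u  ≡⟨ cong (_* u) (x≡y⇒x+y≡0 (sym s1a5≡s3a4)) ⟩
      0# * u                   ≡⟨ zeroˡ u ⟩
      0#                       ∎)
    (begin
      s1 * s1 * (x₀ * x₀) + s3 * s3 * (0# * 0#) + a4 * x₀ + a5 * 0#
        ≡⟨ solve 5 (λ s1 s3 a4 a5 s1⁻¹ → s1 :* s1 :* ((a4 :* s1⁻¹ :* s1⁻¹) :* (a4 :* s1⁻¹ :* s1⁻¹)) :+ s3 :* s3 :* (:0 :* :0)
                                          :+ a4 :* (a4 :* s1⁻¹ :* s1⁻¹) :+ a5 :* :0
                                          := (s1 :* s1⁻¹) :* (s1 :* s1⁻¹) :* (a4 :* a4 :* s1⁻¹ :* s1⁻¹) :+ a4 :* a4 :* s1⁻¹ :* s1⁻¹)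
                  refl s1 s3 a4 a5 (s1 ⁻¹) ⟩
      (s1 * s1 ⁻¹) * (s1 * s1 ⁻¹) * e + e   ≡⟨ cong (_+ e) (trans (*-assoc _ _ e) (trans (x*x⁻¹*y≡y s1≢0 _) (x*x⁻¹*y≡y s1≢0 e))) ⟩
      e + e                                 ≡⟨ x+x≡0 e ⟩
      0#                                    ∎)
    (λ det≡0 → x*y≢0 a4≢0 (x⁻¹≢0 s1≢0) (begin
      a4 * s1 ⁻¹                 ≡⟨ x*x⁻¹*y≡y s1≢0 _ ⟨
      s1 * s1 ⁻¹ * (a4 * s1 ⁻¹)  ≡⟨ solve 4 (λ s1 s3 a4 s1⁻¹ → s1 :* s1⁻¹ :* (a4 :* s1⁻¹) := s3 :* :0 :+ s1 :* (a4 :* s1⁻¹ :* s1⁻¹))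
                                       refl s1 s3 a4 (s1 ⁻¹) ⟩
      s3 * 0# + s1 * x₀          ≡⟨ det≡0 ⟩
      0#                         ∎))
    where
      x₀ = a4 * s1 ⁻¹ * s1 ⁻¹
      e = a4 * a4 * s1 ⁻¹ * s1 ⁻¹

  ¬trivialKernel-slantedLinePair : ∀ {a1 a3 a4 a5} b1 b3 b4 b5 → a1 ≢ 0# → √ a1 * a5 ≡ √ a3 * a4 →
    ¬ (a4 ≡ 0# × a5 ≡ 0#) → ¬ TrivialKernel (coeffs a1 a3 a4 a5 b1 0# b3 b4 b5)
  ¬trivialKernel-slantedLinePair {a1} {a3} {a4} {a5} b1 b3 b4 b5 a1≢0 √a1a5≡√a3a4 a≢0 =
    subst₂ (λ A1 A3 → ¬ TrivialKernel (coeffs A1 A3 a4 a5 b1 0# b3 b4 b5)) (√c*√c≡c a1) (√c*√c≡c a3)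
      (¬trivialKernel-slantedLinePair-squares b1 b3 b4 b5 (√≢0 a1≢0) a4≢0 √a1a5≡√a3a4)
    where
      a4≢0 : a4 ≢ 0#
      a4≢0 a4≡0 = a≢0 (a4≡0 , *-cancelˡ-≡0 (√≢0 a1≢0) (trans √a1a5≡√a3a4 (trans (cong (√ a3 *_) a4≡0) (zeroʳ _))))

  F2Alt⇒b2≡0 : ∀ c → F2Alt F c → Coeffs.b2 c ≡ 0#
  F2Alt⇒b2≡0 c (inj₁ (b2≡0 , _)) = b2≡0
  F2Alt⇒b2≡0 c (inj₂ (_ , b2≡0 , _)) = b2≡0

  F2Alt⇔exactlyOne : ∀ c → Coeffs.b2 c ≡ 0# → F2Alt F c ⇔ ExactlyOne (Coeffs.b1 c ≡ 0#) (Coeffs.b4 c ≡ 0#)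
  F2Alt⇔exactlyOne c b2≡0 = mk⇔ to from
    where
      to : F2Alt F c → ExactlyOne (Coeffs.b1 c ≡ 0#) (Coeffs.b4 c ≡ 0#)
      to (inj₁ (_ , b4≡0 , b1≢0)) = inj₂ (b1≢0 , b4≡0)
      to (inj₂ (b1≡0 , _ , b4≢0)) = inj₁ (b1≡0 , b4≢0)
      from : ExactlyOne (Coeffs.b1 c ≡ 0#) (Coeffs.b4 c ≡ 0#) → F2Alt F c
      from (inj₁ (b1≡0 , b4≢0)) = inj₂ (b1≡0 , b2≡0 , b4≢0)
      from (inj₂ (b1≢0 , b4≡0)) = inj₁ (b2≡0 , b4≡0 , b1≢0)

  oneOfCases⇒trivialKernel : ∀ c → OneOfCases F c → Coeffs.b2 c ≡ 0# × TrivialKernel c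
  oneOfCases⇒trivialKernel c@(coeffs _ _ _ _ b1 _ b3 b4 b5) (inj₁ (refl , refl , refl , a5≢0 , alt))
    with refl ← F2Alt⇒b2≡0 c alt =
      refl , Equivalence.from (trivialKernel-case1 b1 b3 b4 b5 a5≢0) (Equivalence.to (F2Alt⇔exactlyOne c refl) alt)
  oneOfCases⇒trivialKernel (coeffs _ _ _ _ b1 _ b3 b4 b5) (inj₂ (inj₁ (refl , refl , a4≢0 , a5≢0 , refl , one))) =
      refl , Equivalence.from (trivialKernel-case2 b1 b3 b4 b5 a4≢0 a5≢0) one
  oneOfCases⇒trivialKernel c@(coeffs _ _ _ _ b1 _ b3 b4 b5) (inj₂ (inj₂ (inj₁ (refl , refl , refl , a3≢0 , alt))))
    with refl ← F2Alt⇒b2≡0 c alt =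
      refl , Equivalence.from (trivialKernel-case3 b1 b3 b4 b5 a3≢0) (Equivalence.to (F2Alt⇔exactlyOne c refl) alt)
  oneOfCases⇒trivialKernel (coeffs _ a3 _ a5 b1 _ b3 b4 b5) (inj₂ (inj₂ (inj₂ (inj₁ (refl , _ , a4≢0 , refl , roots))))) =
      refl , Equivalence.from (trivialKernel-case4 {a3} {a5 = a5} b1 b3 b4 b5 a4≢0) roots
  oneOfCases⇒trivialKernel (coeffs _ _ _ _ b1 _ b3 b4 b5) (inj₂ (inj₂ (inj₂ (inj₂ (inj₁ (refl , refl , _ , a3≢0 , refl , one)))))) =
      refl , Equivalence.from (trivialKernel-case5 b1 b3 b4 b5 a3≢0) one
  oneOfCases⇒trivialKernel (coeffs _ _ a4 a5 b1 _ b3 b4 b5) (inj₂ (inj₂ (inj₂ (inj₂ (inj₂ (a1≢0 , a3≢0 , √a1a5≢√a3a4 , refl , roots)))))) =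
      refl , Equivalence.from (trivialKernel-case6 {a4 = a4} {a5} b1 b3 b4 b5 a1≢0 a3≢0 √a1a5≢√a3a4) roots

  trivialKernel⇒oneOfCases-a1≡0 : ∀ a3 a4 a5 b1 b3 b4 b5 → let c = coeffs 0# a3 a4 a5 b1 0# b3 b4 b5 in
    TrivialKernel c → OneOfCases F c ⊎ OneOfCases F (swapXY c)
  trivialKernel⇒oneOfCases-a1≡0 a3 a4 a5 b1 b3 b4 b5 triv with a3 ≟ 0#
  ... | yes refl with a4 ≟ 0# | a5 ≟ 0#
  ...   | yes refl | yes refl = ⊥-elim (¬trivialKernel-f1≡0 b1 b3 b4 b5 triv)
  ...   | yes refl | no a5≢0 = inj₁ (inj₁ (refl , refl , refl , a5≢0 ,
          Equivalence.from (F2Alt⇔exactlyOne (coeffs 0# 0# 0# a5 b1 0# b3 b4 b5) refl)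
            (Equivalence.to (trivialKernel-case1 b1 b3 b4 b5 a5≢0) triv)))
  ...   | no a4≢0 | yes refl = inj₂ (inj₁ (refl , refl , refl , a4≢0 ,
          Equivalence.from (F2Alt⇔exactlyOne (coeffs 0# 0# 0# a4 b3 0# b1 b5 b4) refl)
            (Equivalence.to (trivialKernel-case1 b3 b1 b5 b4 a4≢0) (trivialKernel-swapXY _ triv))))
  ...   | no a4≢0 | no a5≢0 = inj₁ (inj₂ (inj₁ (refl , refl , a4≢0 , a5≢0 , refl ,
          Equivalence.to (trivialKernel-case2 b1 b3 b4 b5 a4≢0 a5≢0) triv)))
  trivialKernel⇒oneOfCases-a1≡0 a3 a4 a5 b1 b3 b4 b5 triv | no a3≢0 with a4 ≟ 0#
  ... | no a4≢0 = inj₁ (inj₂ (inj₂ (inj₂ (inj₁ (refl , a3≢0 , a4≢0 , refl ,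
          Equivalence.to (trivialKernel-case4 b1 b3 b4 b5 a4≢0) triv)))))
  ... | yes refl with a5 ≟ 0#
  ...   | yes refl = inj₁ (inj₂ (inj₂ (inj₁ (refl , refl , refl , a3≢0 ,
          Equivalence.from (F2Alt⇔exactlyOne (coeffs 0# a3 0# 0# b1 0# b3 b4 b5) refl)
            (Equivalence.to (trivialKernel-case3 b1 b3 b4 b5 a3≢0) triv)))))
  ...   | no a5≢0 = ⊥-elim (¬trivialKernel-horizontalLinePair b1 b3 b4 b5 a3≢0 a5≢0 triv)

  trivialKernel⇒oneOfCases : ∀ c → Coeffs.b2 c ≡ 0# → TrivialKernel c → OneOfCases F c ⊎ OneOfCases F (swapXY c)
  trivialKernel⇒oneOfCases (coeffs a1 a3 a4 a5 b1 _ b3 b4 b5) refl triv with a1 ≟ 0#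
  ... | yes refl = trivialKernel⇒oneOfCases-a1≡0 a3 a4 a5 b1 b3 b4 b5 triv
  ... | no a1≢0 with a3 ≟ 0#
  ...   | yes refl = Sum.swap (trivialKernel⇒oneOfCases-a1≡0 a1 a5 a4 b3 b1 b5 b4 (trivialKernel-swapXY _ triv))
  ...   | no a3≢0 with (√ a1 * a5) ≟ (√ a3 * a4)
  ...     | no √a1a5≢√a3a4 = inj₁ (inj₂ (inj₂ (inj₂ (inj₂ (inj₂ (a1≢0 , a3≢0 , √a1a5≢√a3a4 , refl ,
            Equivalence.to (trivialKernel-case6 b1 b3 b4 b5 a1≢0 a3≢0 √a1a5≢√a3a4) triv))))))
  ...     | yes √a1a5≡√a3a4 with a4 ≟ 0# | a5 ≟ 0#
  ...       | yes refl | yes refl = inj₁ (inj₂ (inj₂ (inj₂ (inj₂ (inj₁ (refl , refl , a1≢0 , a3≢0 , refl ,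
              Equivalence.to (trivialKernel-case5 b1 b3 b4 b5 a3≢0) triv))))))
  ...       | yes _ | no a5≢0 = ⊥-elim (¬trivialKernel-slantedLinePair b1 b3 b4 b5 a1≢0 √a1a5≡√a3a4 (a5≢0 ∘ proj₂) triv)
  ...       | no a4≢0 | _ = ⊥-elim (¬trivialKernel-slantedLinePair b1 b3 b4 b5 a1≢0 √a1a5≡√a3a4 (a4≢0 ∘ proj₁) triv)

  isPermutation⇔b2≡0×trivialKernel : ∀ c → IsPermutation F c ⇔ (Coeffs.b2 c ≡ 0# × TrivialKernel c)
  isPermutation⇔b2≡0×trivialKernel c = mk⇔
    (λ perm → isPermutation⇒b2≡0 perm , isPermutation⇒trivialKernel perm)
    (λ (b2≡0 , triv) → trivialKernel⇒isPermutation c b2≡0 triv)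

  b2≡0×trivialKernel⇔oneOfCases : ∀ c →
    (Coeffs.b2 c ≡ 0# × TrivialKernel c) ⇔ (OneOfCases F c ⊎ OneOfCases F (swapXY c))
  b2≡0×trivialKernel⇔oneOfCases c = mk⇔
    (λ (b2≡0 , triv) → trivialKernel⇒oneOfCases c b2≡0 triv)
    [ oneOfCases⇒trivialKernel c
    , (λ case → let b2≡0 , triv = oneOfCases⇒trivialKernel (swapXY c) case in b2≡0 , trivialKernel-swapXY c triv) ]′

proposition3p5 : (m : ℕ) (F : F2Field m) (c : Coeffs (F2Field.Carrier F)) →
    (IsPermutation F c → OneOfCases F c ⊎ OneOfCases F (swapXY c)) ×
    (OneOfCases F c ⊎ OneOfCases F (swapXY c) → IsPermutation F c)
proposition3p5 m F c = Equivalence.to classification , Equivalence.from classification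
  where
    classification = ⇔-trans (isPermutation⇔b2≡0×trivialKernel F c) (b2≡0×trivialKernel⇔oneOfCases F c)
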